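{- Let $S,T,U$ be numberings of shape $\lambda\vdash n$. (a) If $U=\pi\cdot T$ where $\pi\in R(T)$, then $v_U^S=v_T^S$. (b) If $U$ is obtained from $T$ by interchanging two rows of $T$ that both have length $\ell$, then $v_U^S=(-1)^\ell v_T^S$.
   Context: A numbering of shape $\lambda\vdash n$ is a filling of the Ferrers diagram of $\lambda$ (English convention) with $1,\dots,n$ each used once; $T(i,j)$ is the entry in row $i$, column $j$. $\mathfrak{S}_n$ acts by $(\pi\cdot T)(i,j)=\pi(T(i,j))$; products in $\mathbb{C}[\mathfrak{S}_n]$ are composition. For numberings $S,T$ of the same shape, $\sigma_{T,S}$ is the unique permutation with $\sigma_{T,S}\cdot T=S$. $R(T)$ (resp. $C(T)$) is the subgroup of permutations preserving the set of entries of each row (resp. column) of $T$; $a_T=\sum_{\rho\in R(T)}\rho$, $b_T=\sum_{\zeta\in C(T)}\mathrm{sgn}(\zeta)\zeta$. Finally $v_T^S=\sigma_{T,S}\,b_Ta_T$. -}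

module Defs where

open import Data.Nat as ℕ using (ℕ; zero; suc; _<_; _≥_)
open import Data.Integer as ℤ using (ℤ; 0ℤ; 1ℤ; -1ℤ)
import Data.Fin
open import Data.Fin using (Fin; zero; suc)
open import Data.Fin.Properties as FinP using (all?)
import Data.Fin.Permutation as P
open import Data.Fin.Permutation using (Permutation′; _⟨$⟩ʳ_; _⟨$⟩ˡ_)
open import Data.List as L using (List; []; _∷_; length; lookup; concatMap; map; filter; allFin)
open import Data.List.Relation.Unary.All using (All)
open import Data.Nat.ListAction using (sum)
open import Data.List.Relation.Unary.Linked using (Linked)
open import Data.Product using (Σ; Σ-syntax; _×_; _,_; proj₁; proj₂)
import Function.Bundles
open import Function.Bundles using (_↔_)
open import Function.Construct.Composition using (_↔-∘_)
open import Function.Construct.Symmetry using (↔-sym)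
open import Relation.Binary.PropositionalEquality using (_≡_)
open import Relation.Nullary using (Dec; yes; no; does)
open import Relation.Unary using (Decidable)
open import Data.Bool using (if_then_else_)

IsPartition : List ℕ → ℕ → Set
IsPartition sh n = Linked _≥_ sh × All (0 <_) sh × sum sh ≡ n

-- Cells of the Ferrers diagram: (row i, column j) with j < λ_i (0-indexed).
Cell : List ℕ → Set
Cell sh = Σ[ i ∈ Fin (length sh) ] Σ[ j ∈ ℕ ] j < lookup sh i

rowOfCell : ∀ sh → Cell sh → Fin (length sh)
rowOfCell _ = proj₁

colOfCell : ∀ sh → Cell sh → ℕ
colOfCell _ c = proj₁ (proj₂ c)

-- A numbering of shape sh with 1..n (represented as Fin n): a bijection
-- cells → entries;  T(i,j) = Inverse.to T (i , j , _).
record Numbering (sh : List ℕ) (n : ℕ) : Set where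
  constructor numbering
  field bij : Cell sh ↔ Fin n
open Numbering public

open Function.Bundles.Inverse using (to; from)

entry : ∀ {sh n} → Numbering sh n → Cell sh → Fin n
entry T = to (bij T)

rowOf : ∀ {sh n} → Numbering sh n → Fin n → Fin (length sh)
rowOf {sh} T k = rowOfCell sh (from (bij T) k)

colOf : ∀ {sh n} → Numbering sh n → Fin n → ℕ
colOf {sh} T k = colOfCell sh (from (bij T) k)

-- (p ⊙ q)(k) = p (q k)
_⊙_ : ∀ {n} → Permutation′ n → Permutation′ n → Permutation′ n
p ⊙ q = p ↔-∘ q

_·_ : ∀ {sh n} → Permutation′ n → Numbering sh n → Numbering sh n
π · T = numbering (π ↔-∘ bij T)

-- σ_{T,S}: the permutation with σ_{T,S} · T = S, i.e. σ_{T,S} = S ∘ T⁻¹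
σ : ∀ {sh n} → Numbering sh n → Numbering sh n → Permutation′ n
σ T S = bij S ↔-∘ ↔-sym (bij T)

-- R(T), C(T) as predicates on permutations: π preserves the set of
-- entries of each row (column) iff every entry stays in its row (column).
InR : ∀ {sh n} → Numbering sh n → Permutation′ n → Set
InR T π = ∀ k → rowOf T (π ⟨$⟩ʳ k) ≡ rowOf T k

InC : ∀ {sh n} → Numbering sh n → Permutation′ n → Set
InC T π = ∀ k → colOf T (π ⟨$⟩ʳ k) ≡ colOf T k

InR? : ∀ {sh n} (T : Numbering sh n) → Decidable (InR T)
InR? T π = all? (λ k → rowOf T (π ⟨$⟩ʳ k) FinP.≟ rowOf T k)

InC? : ∀ {sh n} (T : Numbering sh n) → Decidable (InC T)
InC? T π = all? (λ k → colOf T (π ⟨$⟩ʳ k) ℕ.≟ colOf T k)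

-- Enumeration of 𝔖_n, every permutation exactly once:
-- 𝔖_{n+1} = { (0 i) ∘ lift₀ π | i ∈ Fin (n+1), π ∈ 𝔖_n }.
allPerms : (n : ℕ) → List (Permutation′ n)
allPerms zero = P.id ∷ []
allPerms (suc n) =
  concatMap (λ i → map (λ π → P.transpose zero i ⊙ P.lift₀ π) (allPerms n))
            (allFin (suc n))

inversions : ∀ {n} → Permutation′ n → ℕ
inversions {n} π =
  L.length (filter (λ ij → (π ⟨$⟩ʳ proj₂ ij) Data.Fin.<? (π ⟨$⟩ʳ proj₁ ij))
    (filter (λ ij → proj₁ ij Data.Fin.<? proj₂ ij)
      (L.cartesianProduct (allFin n) (allFin n))))

sgn : ∀ {n} → Permutation′ n → ℤ
sgn π = -1ℤ ℤ.^ inversions π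

-- The group algebra ℤ[𝔖_n] ⊆ ℂ[𝔖_n] as formal sums Σ c_g g

GA : ℕ → Set
GA n = List (ℤ × Permutation′ n)

coeff : ∀ {n} → GA n → Permutation′ n → ℤ
coeff [] g = 0ℤ
coeff ((c , p) ∷ xs) g with all? (λ k → (p ⟨$⟩ʳ k) FinP.≟ (g ⟨$⟩ʳ k))
... | yes _ = c ℤ.+ coeff xs g
... | no  _ = coeff xs g

infix 4 _≈_
_≈_ : ∀ {n} → GA n → GA n → Set
x ≈ y = ∀ g → coeff x g ≡ coeff y g

[_] : ∀ {n} → Permutation′ n → GA n
[ g ] = (1ℤ , g) ∷ []

infixl 7 _*_
_*_ : ∀ {n} → GA n → GA n → GA n
x * y = concatMap (λ cp → map (λ dq → (proj₁ cp ℤ.* proj₁ dq , proj₂ cp ⊙ proj₂ dq)) y) x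

infixr 7 _•_
_•_ : ∀ {n} → ℤ → GA n → GA n
s • x = map (λ cp → (s ℤ.* proj₁ cp , proj₂ cp)) x

a : ∀ {sh n} → Numbering sh n → GA n
a {n = n} T = map (λ ρ → (1ℤ , ρ)) (filter (InR? T) (allPerms n))

b : ∀ {sh n} → Numbering sh n → GA n
b {n = n} T = map (λ ζ → (sgn ζ , ζ)) (filter (InC? T) (allPerms n))

v : ∀ {sh n} → Numbering sh n → Numbering sh n → GA n
v T S = [ σ T S ] * b T * a T

swapRow : ∀ {m} → Fin m → Fin m → Fin m → Fin m
swapRow r₁ r₂ i =
  if does (i FinP.≟ r₁) then r₂ else (if does (i FinP.≟ r₂) then r₁ else i)

-- The coefficient of g in v_T^S = σ_{T,S} b_T a_T is the sum, over ζ ∈ C(T), of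
-- sgn ζ · [(σ_{T,S} ζ)⁻¹ g ∈ R(T)].  If U = π · T then σ_{U,S} = σ_{T,S} π⁻¹, and
-- the rows and columns of U are those of T relabelled by π.
-- (a) For π ∈ R(T) the rows of U are those of T, the columns of U are π C(T) π⁻¹,
--     and the substitution ζ ↦ π ζ π⁻¹ identifies the two sums term by term,
--     since sgn is invariant under conjugation.
-- (b) Swapping two rows of length ℓ is U = τ · T for the involution τ ∈ C(T) that
--     exchanges the two rows column by column.  U and T have the same row sets
--     and the same columns, so the substitution ζ ↦ τ ζ pulls out sgn τ, and
--     sgn τ = (-1)^ℓ as τ is a product of ℓ disjoint transpositions.
-- Multiplicativity of sgn comes from counting inversions: a pair i < j is flipped
-- by σ ∘ τ iff it is flipped by exactly one of τ (at i, j) and σ (at τ i, τ j), so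
-- inversions (σ ∘ τ) and inversions σ + inversions τ differ by an even number.
module Submission where

open import Algebra.Bundles using (CommutativeSemiring)
import Algebra.Properties.CommutativeSemigroup
open import Data.Bool using (Bool; true; false; if_then_else_; not; _xor_)
open import Data.Bool.Properties using (not-involutive; xor-same)
open import Data.Empty using (⊥-elim)
open import Data.Fin as F using (Fin; zero; suc)
open import Data.Fin.Properties using (_≟_; _<?_; <-cmp; <-irrefl; all?; suc-injective)
open import Data.Fin.Permutation as P using (Permutation′; _⟨$⟩ʳ_; _⟨$⟩ˡ_) renaming (_≈_ to _≈ₚ_)
import Data.Fin.Permutation.Components as PC
open import Data.Integer as ℤ using (ℤ; 0ℤ; 1ℤ; -1ℤ; _^_)
import Data.Integer.Properties as ℤP
open import Data.List using (List; []; _∷_; _++_; length; lookup; map; concatMap; filter; allFin; cartesianProduct)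
open import Data.List.Properties using (map-tabulate)
open import Data.Nat as ℕ using (ℕ; zero; suc)
import Data.Nat.Properties as ℕP
open import Data.Product using (Σ; _×_; _,_; proj₁; proj₂)
open import Data.Sum using (inj₁; inj₂)
open import Function using (_∘_; id)
open import Function.Bundles using (_⇔_; mk⇔; Equivalence; Inverse)
open import Function.Construct.Composition using (_⇔-∘_)
open import Level using (Level; _⊔_)
open import Relation.Binary.Core using (Rel; _Preserves_⟶_)
open import Relation.Binary.Definitions using (Symmetric; _Respects_; tri<; tri≈; tri>)
  renaming (Decidable to Decidable₂)
import Relation.Binary.PropositionalEquality as ≡
open ≡ using (_≡_; _≢_)
open import Relation.Nullary using (Dec; does; yes; no; ¬_)
open import Relation.Nullary.Decidable using (does-⇔; dec-true; dec-false)
open import Relation.Unary using (Decidable)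

module ℤ* = Algebra.Properties.CommutativeSemigroup ℤP.*-commutativeSemigroup

-- Sums over lists

module ListSum {c ℓ} (R : CommutativeSemiring c ℓ) where
  open CommutativeSemiring R hiding (zero)
  open import Algebra.Properties.CommutativeSemigroup +-commutativeSemigroup using (interchange)
  open import Relation.Binary.Reasoning.Setoid setoid

  private variable
    a b : Level
    A : Set a
    B : Set b

  ∑ : List A → (A → Carrier) → Carrier
  ∑ []       f = 0#
  ∑ (x ∷ xs) f = f x + ∑ xs f

  ∑-cong : ∀ (xs : List A) {f g : A → Carrier} → (∀ x → f x ≈ g x) → ∑ xs f ≈ ∑ xs g
  ∑-cong []       f≈g = refl
  ∑-cong (x ∷ xs) f≈g = +-cong (f≈g x) (∑-cong xs f≈g)

  ∑-++ : ∀ (xs ys : List A) f → ∑ (xs ++ ys) f ≈ ∑ xs f + ∑ ys f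
  ∑-++ []       ys f = sym (+-identityˡ _)
  ∑-++ (x ∷ xs) ys f = trans (+-congˡ (∑-++ xs ys f)) (sym (+-assoc _ _ _))

  ∑-zero : ∀ (xs : List A) → ∑ xs (λ _ → 0#) ≈ 0#
  ∑-zero []       = refl
  ∑-zero (x ∷ xs) = trans (+-identityˡ _) (∑-zero xs)

  ∑-distrib-+ : ∀ (xs : List A) f g → ∑ xs (λ x → f x + g x) ≈ ∑ xs f + ∑ xs g
  ∑-distrib-+ []       f g = sym (+-identityˡ _)
  ∑-distrib-+ (x ∷ xs) f g = trans (+-congˡ (∑-distrib-+ xs f g)) (interchange _ _ _ _)

  *-distribˡ-∑ : ∀ (xs : List A) r f → r * ∑ xs f ≈ ∑ xs (λ x → r * f x)
  *-distribˡ-∑ []       r f = zeroʳ r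
  *-distribˡ-∑ (x ∷ xs) r f = trans (distribˡ r _ _) (+-congˡ (*-distribˡ-∑ xs r f))

  ∑-filter : ∀ {p} {P : A → Set p} (P? : Decidable P) xs f →
             ∑ (filter P? xs) f ≈ ∑ xs (λ x → if does (P? x) then f x else 0#)
  ∑-filter P? []       f = refl
  ∑-filter P? (x ∷ xs) f with does (P? x)
  ... | true  = +-congˡ (∑-filter P? xs f)
  ... | false = trans (∑-filter P? xs f) (sym (+-identityˡ _))

  ∑-map : ∀ (g : A → B) xs f → ∑ (map g xs) f ≡ ∑ xs (f ∘ g)
  ∑-map g []       f = ≡.refl
  ∑-map g (x ∷ xs) f = ≡.cong (f (g x) +_) (∑-map g xs f)

  ∑-concatMap : ∀ (g : A → List B) xs f → ∑ (concatMap g xs) f ≈ ∑ xs (λ x → ∑ (g x) f)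
  ∑-concatMap g []       f = refl
  ∑-concatMap g (x ∷ xs) f = trans (∑-++ (g x) _ f) (+-congˡ (∑-concatMap g xs f))

  ∑-comm : ∀ (xs : List A) (ys : List B) (f : A → B → Carrier) →
           ∑ xs (λ x → ∑ ys (f x)) ≈ ∑ ys (λ y → ∑ xs (λ x → f x y))
  ∑-comm []       ys f = sym (∑-zero ys)
  ∑-comm (x ∷ xs) ys f =
    trans (+-congˡ (∑-comm xs ys f)) (sym (∑-distrib-+ ys (f x) (λ y → ∑ xs (λ x → f x y))))

  ∑-cartesianProduct : ∀ (xs : List A) (ys : List B) f →
                       ∑ (cartesianProduct xs ys) f ≈ ∑ xs (λ x → ∑ ys (λ y → f (x , y)))
  ∑-cartesianProduct []       ys f = refl
  ∑-cartesianProduct (x ∷ xs) ys f = begin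
    ∑ (map (x ,_) ys ++ cartesianProduct xs ys) f                ≈⟨ ∑-++ (map (x ,_) ys) _ f ⟩
    ∑ (map (x ,_) ys) f + ∑ (cartesianProduct xs ys) f           ≈⟨ +-cong (reflexive (∑-map (x ,_) ys f))
                                                                              (∑-cartesianProduct xs ys f) ⟩
    ∑ ys (λ y → f (x , y)) + ∑ xs (λ x → ∑ ys (λ y → f (x , y))) ∎

  δ : ∀ {r} {_~_ : Rel A r} → Decidable₂ _~_ → A → A → Carrier
  δ _~?_ x y = if does (x ~? y) then 1# else 0#

  δ-⇔ : ∀ {r s} {_~_ : Rel A r} {_≃_ : Rel B s} (_~?_ : Decidable₂ _~_) (_≃?_ : Decidable₂ _≃_) →
        ∀ {x y x′ y′} → x ~ y ⇔ x′ ≃ y′ → δ _~?_ x y ≡ δ _≃?_ x′ y′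
  δ-⇔ _~?_ _≃?_ {x} {y} {x′} {y′} x~y⇔x′≃y′ =
    ≡.cong (λ b → if b then 1# else 0#) (does-⇔ x~y⇔x′≃y′ (x ~? y) (x′ ≃? y′))

  δ-~ : ∀ {r} {_~_ : Rel A r} (_~?_ : Decidable₂ _~_) {x y} → x ~ y → δ _~?_ x y ≡ 1#
  δ-~ _~?_ {x} {y} x~y with x ~? y
  ... | yes _   = ≡.refl
  ... | no  x≁y = ⊥-elim (x≁y x~y)

  δ-≁ : ∀ {r} {_~_ : Rel A r} (_~?_ : Decidable₂ _~_) {x y} → ¬ (x ~ y) → δ _~?_ x y ≡ 0#
  δ-≁ _~?_ {x} {y} x≁y with x ~? y
  ... | yes x~y = ⊥-elim (x≁y x~y)
  ... | no  _   = ≡.refl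

  module _ {a r} {X : Set a} {_~_ : Rel X r} (_~?_ : Decidable₂ _~_) where

    Enumerates : List X → Set (a ⊔ ℓ)
    Enumerates xs = ∀ z → ∑ xs (λ y → δ _~?_ y z) ≈ 1#

    module _ {xs : List X} (enum : Enumerates xs) {f : X → Carrier} (f-resp : f Preserves _~_ ⟶ _≈_) where

      ∑-δ : ∀ z → ∑ xs (λ y → f y * δ _~?_ y z) ≈ f z
      ∑-δ z = begin
        ∑ xs (λ y → f y * δ _~?_ y z) ≈⟨ ∑-cong xs move ⟩
        ∑ xs (λ y → f z * δ _~?_ y z) ≈⟨ *-distribˡ-∑ xs (f z) (λ y → δ _~?_ y z) ⟨
        f z * ∑ xs (λ y → δ _~?_ y z) ≈⟨ *-congˡ (enum z) ⟩
        f z * 1#                 ≈⟨ *-identityʳ (f z) ⟩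
        f z                      ∎
        where
        move : ∀ y → f y * δ _~?_ y z ≈ f z * δ _~?_ y z
        move y with y ~? z
        ... | yes y~z = *-congʳ (f-resp y~z)
        ... | no  _   = trans (zeroʳ (f y)) (sym (zeroʳ (f z)))

      ∑-reindex : Symmetric _~_ → (h h⁻¹ : X → X) → (∀ {x y} → h x ~ y ⇔ x ~ h⁻¹ y) →
                  ∑ xs (f ∘ h) ≈ ∑ xs f
      ∑-reindex ~-sym h h⁻¹ h⇔h⁻¹ = begin
        ∑ xs (f ∘ h)                                   ≈⟨ ∑-cong xs (λ x → ∑-δ (h x)) ⟨
        ∑ xs (λ x → ∑ xs (λ y → f y * δ _~?_ y (h x))) ≈⟨ ∑-comm xs xs (λ x y → f y * δ _~?_ y (h x)) ⟩
        ∑ xs (λ y → ∑ xs (λ x → f y * δ _~?_ y (h x))) ≈⟨ ∑-cong xs (λ y → *-distribˡ-∑ xs (f y) _) ⟨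
        ∑ xs (λ y → f y * ∑ xs (λ x → δ _~?_ y (h x))) ≈⟨ ∑-cong xs (λ y → *-congˡ (count y)) ⟩
        ∑ xs (λ y → f y * 1#)                          ≈⟨ ∑-cong xs (λ y → *-identityʳ (f y)) ⟩
        ∑ xs f                                         ∎
        where
        δ-flip : ∀ y x → δ _~?_ y (h x) ≡ δ _~?_ x (h⁻¹ y)
        δ-flip y x = δ-⇔ _~?_ _~?_ (mk⇔ (Equivalence.to h⇔h⁻¹ ∘ ~-sym) (~-sym ∘ Equivalence.from h⇔h⁻¹))
        count : ∀ y → ∑ xs (λ x → δ _~?_ y (h x)) ≈ 1#
        count y = trans (∑-cong xs (λ x → reflexive (δ-flip y x))) (enum (h⁻¹ y))

  ∑-allFin-suc : ∀ {n} (f : Fin (suc n) → Carrier) → ∑ (allFin (suc n)) f ≡ f zero + ∑ (allFin n) (f ∘ suc)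
  ∑-allFin-suc {n} f = ≡.cong (f zero +_)
    (≡.trans (≡.cong (λ ys → ∑ ys f) (≡.sym (map-tabulate id suc))) (∑-map suc (allFin n) f))

  allFin-enumerates : ∀ n → Enumerates _≟_ (allFin n)
  allFin-enumerates (suc n) zero = begin
    ∑ (allFin (suc n)) (λ y → δ _≟_ y zero) ≡⟨ ∑-allFin-suc {n} (λ y → δ _≟_ y zero) ⟩
    1# + ∑ (allFin n) (λ _ → 0#)            ≈⟨ +-congˡ (∑-zero (allFin n)) ⟩
    1# + 0#                                 ≈⟨ +-identityʳ 1# ⟩
    1#                                      ∎
  allFin-enumerates (suc n) (suc z) = begin
    ∑ (allFin (suc n)) (λ y → δ _≟_ y (suc z)) ≡⟨ ∑-allFin-suc {n} (λ y → δ _≟_ y (suc z)) ⟩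
    0# + ∑ (allFin n) (λ y → δ _≟_ y z)        ≈⟨ +-identityˡ _ ⟩
    ∑ (allFin n) (λ y → δ _≟_ y z)             ≈⟨ allFin-enumerates n z ⟩
    1#                                         ∎

open import Defs

-- Permutations

infix 30 _⁻¹
_⁻¹ : ∀ {n} → Permutation′ n → Permutation′ n
_⁻¹ = P.flip

infix 4 _≈ₚ?_
_≈ₚ?_ : ∀ {n} → Decidable₂ (_≈ₚ_ {n} {n})
π ≈ₚ? ρ = all? (λ k → π ⟨$⟩ʳ k ≟ ρ ⟨$⟩ʳ k)

⟨$⟩ʳ≡⇔≡⟨$⟩ˡ : ∀ {n} (π : Permutation′ n) {i j} → π ⟨$⟩ʳ i ≡ j ⇔ i ≡ π ⟨$⟩ˡ j
⟨$⟩ʳ≡⇔≡⟨$⟩ˡ π = mk⇔ (λ πi≡j → ≡.sym (Inverse.inverseʳ π (≡.sym πi≡j))) (Inverse.inverseˡ π)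

⟨$⟩ʳ-injective : ∀ {n} (π : Permutation′ n) {i j} → π ⟨$⟩ʳ i ≡ π ⟨$⟩ʳ j → i ≡ j
⟨$⟩ʳ-injective π πi≡πj = ≡.trans (Equivalence.to (⟨$⟩ʳ≡⇔≡⟨$⟩ˡ π) πi≡πj) (P.inverseˡ π)

⁻¹-cong : ∀ {n} {π ρ : Permutation′ n} → π ≈ₚ ρ → π ⁻¹ ≈ₚ ρ ⁻¹
⁻¹-cong {π = π} {ρ} π≈ρ k =
  ≡.trans (≡.sym (P.inverseˡ ρ)) (≡.cong (ρ ⁻¹ ⟨$⟩ʳ_) (≡.trans (≡.sym (π≈ρ (π ⁻¹ ⟨$⟩ʳ k))) (P.inverseʳ π)))

≈ₚ-sym : ∀ {n} → Symmetric (_≈ₚ_ {n} {n})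
≈ₚ-sym π≈ρ k = ≡.sym (π≈ρ k)

transpose-matchˡ : ∀ {n} (i j : Fin n) → PC.transpose i j i ≡ j
transpose-matchˡ i j with i ≟ i
... | yes _   = ≡.refl
... | no  i≢i = ⊥-elim (i≢i ≡.refl)

transpose-matchʳ : ∀ {n} (i j : Fin n) → PC.transpose i j j ≡ i
transpose-matchʳ i j with j ≟ i
... | yes j≡i = j≡i
... | no  _ with j ≟ j
...   | yes _   = ≡.refl
...   | no  j≢j = ⊥-elim (j≢j ≡.refl)

transpose-mismatch : ∀ {n} {i j k : Fin n} → k ≢ i → k ≢ j → PC.transpose i j k ≡ k
transpose-mismatch {i = i} {j} {k} k≢i k≢j with k ≟ i
... | yes k≡i = ⊥-elim (k≢i k≡i)
... | no  _ with k ≟ j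
...   | yes k≡j = ⊥-elim (k≢j k≡j)
...   | no  _   = ≡.refl

module _ {n} (g : Permutation′ (suc n)) (i : Fin (suc n)) where

  private
    t = P.transpose zero i

  transpose-lift₀-≉ : i ≢ g ⟨$⟩ʳ zero → ∀ π → ¬ (t ⊙ P.lift₀ π ≈ₚ g)
  transpose-lift₀-≉ i≢g0 π tπ≈g = i≢g0 (tπ≈g zero)

  transpose-lift₀-≈ : i ≡ g ⟨$⟩ʳ zero → ∀ π → t ⊙ P.lift₀ π ≈ₚ g ⇔ π ≈ₚ P.remove zero (t ⁻¹ ⊙ g)
  transpose-lift₀-≈ i≡g0 π = mk⇔ to from
    where
    q = t ⁻¹ ⊙ g
    lift₀-g′≈q : P.lift₀ (P.remove zero q) ≈ₚ q
    lift₀-g′≈q = P.lift₀-remove q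
      (≡.trans (≡.cong (PC.transpose i zero) (≡.sym i≡g0)) (transpose-matchˡ i zero))
    to : t ⊙ P.lift₀ π ≈ₚ g → π ≈ₚ P.remove zero q
    to tπ≈g k = suc-injective (begin
      suc (π ⟨$⟩ʳ k)                       ≡⟨ P.inverseˡ t ⟨
      t ⁻¹ ⟨$⟩ʳ (t ⊙ P.lift₀ π ⟨$⟩ʳ suc k) ≡⟨ ≡.cong (t ⁻¹ ⟨$⟩ʳ_) (tπ≈g (suc k)) ⟩
      q ⟨$⟩ʳ suc k                         ≡⟨ lift₀-g′≈q (suc k) ⟨
      suc (P.remove zero q ⟨$⟩ʳ k)         ∎)
      where open ≡.≡-Reasoning
    from : π ≈ₚ P.remove zero q → t ⊙ P.lift₀ π ≈ₚ g
    from π≈g′ k =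
      ≡.trans (≡.cong (t ⟨$⟩ʳ_) (≡.trans (P.lift₀-cong π _ π≈g′ k) (lift₀-g′≈q k))) (P.inverseʳ t)

module PermutationSum {c ℓ} (R : CommutativeSemiring c ℓ) where
  open CommutativeSemiring R using (Carrier; 0#; 1#; +-identityʳ; reflexive; trans) renaming (_≈_ to _≈ᴿ_)
  open ListSum R
  open import Relation.Binary.Reasoning.Setoid (CommutativeSemiring.setoid R)

  allPerms-enumerates : ∀ n → Enumerates _≈ₚ?_ (allPerms n)
  allPerms-enumerates zero    g = +-identityʳ 1#
  allPerms-enumerates (suc n) g = begin
    ∑ (allPerms (suc n)) (λ y → δ _≈ₚ?_ y g)
      ≈⟨ ∑-concatMap (λ i → map (shift i) (allPerms n)) (allFin (suc n)) _ ⟩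
    ∑ (allFin (suc n)) (λ i → ∑ (map (shift i) (allPerms n)) (λ y → δ _≈ₚ?_ y g))
      ≈⟨ ∑-cong (allFin (suc n)) (λ i → trans (reflexive (∑-map (shift i) (allPerms n) _)) (fibre i)) ⟩
    ∑ (allFin (suc n)) (λ i → δ _≟_ i (g ⟨$⟩ʳ zero))
      ≈⟨ allFin-enumerates (suc n) (g ⟨$⟩ʳ zero) ⟩
    1# ∎
    where
    shift : Fin (suc n) → Permutation′ n → Permutation′ (suc n)
    shift i π = P.transpose zero i ⊙ P.lift₀ π
    fibre : ∀ i → ∑ (allPerms n) (λ π → δ _≈ₚ?_ (shift i π) g) ≈ᴿ δ _≟_ i (g ⟨$⟩ʳ zero)
    fibre i = by (i ≟ g ⟨$⟩ʳ zero)
      where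
      g′ = P.remove zero (P.transpose zero i ⁻¹ ⊙ g)
      by : Dec (i ≡ g ⟨$⟩ʳ zero) → ∑ (allPerms n) (λ π → δ _≈ₚ?_ (shift i π) g) ≈ᴿ δ _≟_ i (g ⟨$⟩ʳ zero)
      by (yes i≡g0) = begin
        ∑ (allPerms n) (λ π → δ _≈ₚ?_ (shift i π) g) ≈⟨ ∑-cong (allPerms n) (reflexive ∘ δ-shift) ⟩
        ∑ (allPerms n) (λ π → δ _≈ₚ?_ π g′)          ≈⟨ allPerms-enumerates n g′ ⟩
        1#                                           ≡⟨ δ-~ _≟_ i≡g0 ⟨
        δ _≟_ i (g ⟨$⟩ʳ zero)                        ∎
        where
        δ-shift : ∀ π → δ _≈ₚ?_ (shift i π) g ≡ δ _≈ₚ?_ π g′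
        δ-shift π = δ-⇔ _≈ₚ?_ _≈ₚ?_ {shift i π} {g} {π} {g′} (transpose-lift₀-≈ g i i≡g0 π)
      by (no i≢g0) = begin
        ∑ (allPerms n) (λ π → δ _≈ₚ?_ (shift i π) g) ≈⟨ ∑-cong (allPerms n) (reflexive ∘ δ-shift) ⟩
        ∑ (allPerms n) (λ _ → 0#)                    ≈⟨ ∑-zero (allPerms n) ⟩
        0#                                           ≡⟨ δ-≁ _≟_ i≢g0 ⟨
        δ _≟_ i (g ⟨$⟩ʳ zero)                        ∎
        where
        δ-shift : ∀ π → δ _≈ₚ?_ (shift i π) g ≡ 0#
        δ-shift π = δ-≁ _≈ₚ?_ {shift i π} {g} (transpose-lift₀-≉ g i i≢g0 π)

  ∑-translate : ∀ {n} {f : Permutation′ n → Carrier} → f Preserves _≈ₚ_ ⟶ _≈ᴿ_ →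
                ∀ α β → ∑ (allPerms n) (λ ζ → f (α ⊙ (ζ ⊙ β))) ≈ᴿ ∑ (allPerms n) f
  ∑-translate {n} f-resp α β =
    ∑-reindex _≈ₚ?_ {allPerms n} (allPerms-enumerates n) f-resp (λ {x} {y} → ≈ₚ-sym {x = x} {y})
              (λ ζ → α ⊙ (ζ ⊙ β)) (λ y → α ⁻¹ ⊙ (y ⊙ β ⁻¹)) (λ {ζ} {y} → mk⇔ (to {ζ} {y}) (from {ζ} {y}))
    where
    to : ∀ {ζ y} → α ⊙ (ζ ⊙ β) ≈ₚ y → ζ ≈ₚ α ⁻¹ ⊙ (y ⊙ β ⁻¹)
    to {ζ} {y} αζβ≈y k = ≡.trans (≡.sym (P.inverseˡ α)) (≡.cong (α ⁻¹ ⟨$⟩ʳ_)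
      (≡.trans (≡.cong (λ j → α ⟨$⟩ʳ (ζ ⟨$⟩ʳ j)) (≡.sym (P.inverseʳ β))) (αζβ≈y (β ⁻¹ ⟨$⟩ʳ k))))
    from : ∀ {ζ y} → ζ ≈ₚ α ⁻¹ ⊙ (y ⊙ β ⁻¹) → α ⊙ (ζ ⊙ β) ≈ₚ y
    from {ζ} {y} ζ≈α⁻¹yβ⁻¹ k = ≡.trans (≡.cong (α ⟨$⟩ʳ_) (ζ≈α⁻¹yβ⁻¹ (β ⟨$⟩ʳ k)))
      (≡.trans (P.inverseʳ α) (≡.cong (y ⟨$⟩ʳ_) (P.inverseˡ β)))

  ∑-translateˡ : ∀ {n} {f : Permutation′ n → Carrier} → f Preserves _≈ₚ_ ⟶ _≈ᴿ_ →
                 ∀ α → ∑ (allPerms n) (λ ζ → f (α ⊙ ζ)) ≈ᴿ ∑ (allPerms n) f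
  ∑-translateˡ {n} f-resp α =
    trans (∑-cong (allPerms n) (λ ζ → f-resp {α ⊙ ζ} {α ⊙ (ζ ⊙ P.id)} (λ _ → ≡.refl))) (∑-translate f-resp α P.id)

-- The sign of a permutation

module ℕΣ = ListSum ℕP.+-*-commutativeSemiring
module ℤΣ = ListSum ℤP.+-*-commutativeSemiring
module ℤPerm = PermutationSum ℤP.+-*-commutativeSemiring

𝟙 : Bool → ℕ
𝟙 true  = 1
𝟙 false = 0

infix 4 _<ᵇ_
_<ᵇ_ : ∀ {n} → Fin n → Fin n → Bool
i <ᵇ j = does (i <? j)

<ᵇ-irrefl : ∀ {n} (i : Fin n) → (i <ᵇ i) ≡ false
<ᵇ-irrefl i = dec-false (i <? i) (<-irrefl ≡.refl)

<ᵇ-flip : ∀ {n} {i j : Fin n} → i ≢ j → (j <ᵇ i) ≡ not (i <ᵇ j)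
<ᵇ-flip {i = i} {j} i≢j with <-cmp i j
... | tri< i<j _ j≮i rewrite dec-true (i <? j) i<j | dec-false (j <? i) j≮i = ≡.refl
... | tri≈ _ i≡j _   = ⊥-elim (i≢j i≡j)
... | tri> i≮j _ j<i rewrite dec-false (i <? j) i≮j | dec-true (j <? i) j<i = ≡.refl

<ᵇ⇒≢ : ∀ {n} {i j : Fin n} → (i <ᵇ j) ≡ true → i ≢ j
<ᵇ⇒≢ {i = i} i<ᵇi ≡.refl with () ← ≡.trans (≡.sym i<ᵇi) (<ᵇ-irrefl i)

Flips : ∀ {n} → Permutation′ n → Fin n → Fin n → Bool
Flips π i j = (i <ᵇ j) xor (π ⟨$⟩ʳ i <ᵇ π ⟨$⟩ʳ j)

∑² : ∀ n → (Fin n → Fin n → ℕ) → ℕ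
∑² n f = ℕΣ.∑ (allFin n) (λ i → ℕΣ.∑ (allFin n) (f i))

∑< : ∀ n → (Fin n → Fin n → ℕ) → ℕ
∑< n f = ∑² n (λ i j → 𝟙 (i <ᵇ j) ℕ.* f i j)

∑²-cong : ∀ n {f g : Fin n → Fin n → ℕ} → (∀ i j → f i j ≡ g i j) → ∑² n f ≡ ∑² n g
∑²-cong n f≡g = ℕΣ.∑-cong (allFin n) (λ i → ℕΣ.∑-cong (allFin n) (f≡g i))

∑²-distrib-+ : ∀ n (f g : Fin n → Fin n → ℕ) → ∑² n (λ i j → f i j ℕ.+ g i j) ≡ ∑² n f ℕ.+ ∑² n g
∑²-distrib-+ n f g = ≡.trans (ℕΣ.∑-cong (allFin n) (λ i → ℕΣ.∑-distrib-+ (allFin n) (f i) (g i)))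
                             (ℕΣ.∑-distrib-+ (allFin n) _ _)

*-distribˡ-∑² : ∀ n c (f : Fin n → Fin n → ℕ) → c ℕ.* ∑² n f ≡ ∑² n (λ i j → c ℕ.* f i j)
*-distribˡ-∑² n c f = ≡.trans (ℕΣ.*-distribˡ-∑ (allFin n) c _)
                              (ℕΣ.∑-cong (allFin n) (λ i → ℕΣ.*-distribˡ-∑ (allFin n) c (f i)))

∑²-transpose : ∀ n (f : Fin n → Fin n → ℕ) → ∑² n (λ i j → f j i) ≡ ∑² n f
∑²-transpose n f = ℕΣ.∑-comm (allFin n) (allFin n) (λ i j → f j i)

∑²-reindex : ∀ n (π : Permutation′ n) (f : Fin n → Fin n → ℕ) →
             ∑² n (λ i j → f (π ⟨$⟩ʳ i) (π ⟨$⟩ʳ j)) ≡ ∑² n f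
∑²-reindex n π f = ≡.trans (ℕΣ.∑-cong (allFin n) (λ i → reindex (f (π ⟨$⟩ʳ i))))
                           (reindex (λ i → ℕΣ.∑ (allFin n) (f i)))
  where
  reindex : (h : Fin n → ℕ) → ℕΣ.∑ (allFin n) (λ i → h (π ⟨$⟩ʳ i)) ≡ ℕΣ.∑ (allFin n) h
  reindex h = ℕΣ.∑-reindex _≟_ {allFin n} (ℕΣ.allFin-enumerates n) (≡.cong h) ≡.sym
                            (π ⟨$⟩ʳ_) (π ⟨$⟩ˡ_) (⟨$⟩ʳ≡⇔≡⟨$⟩ˡ π)

∑²≡2*∑< : ∀ n (g : Fin n → Fin n → ℕ) → (∀ i j → g i j ≡ g j i) → (∀ i → g i i ≡ 0) →
          ∑² n g ≡ 2 ℕ.* ∑< n g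
∑²≡2*∑< n g g-sym g-diag = begin
  ∑² n g                                                            ≡⟨ ∑²-cong n split ⟩
  ∑² n (λ i j → 𝟙 (i <ᵇ j) ℕ.* g i j ℕ.+ 𝟙 (j <ᵇ i) ℕ.* g i j)      ≡⟨ ∑²-distrib-+ n _ _ ⟩
  ∑< n g ℕ.+ ∑² n (λ i j → 𝟙 (j <ᵇ i) ℕ.* g i j)                   ≡⟨ ≡.cong (∑< n g ℕ.+_) upper≡lower ⟩
  ∑< n g ℕ.+ ∑< n g                                                 ≡⟨ ≡.cong (∑< n g ℕ.+_) (ℕP.+-identityʳ _) ⟨
  2 ℕ.* ∑< n g                                                      ∎
  where
  open ≡.≡-Reasoning
  split : ∀ i j → g i j ≡ 𝟙 (i <ᵇ j) ℕ.* g i j ℕ.+ 𝟙 (j <ᵇ i) ℕ.* g i j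
  split i j with <-cmp i j
  ... | tri< i<j _ j≮i rewrite dec-true (i <? j) i<j | dec-false (j <? i) j≮i =
    ≡.sym (≡.trans (ℕP.+-identityʳ _) (ℕP.+-identityʳ _))
  ... | tri≈ _ ≡.refl _ rewrite <ᵇ-irrefl i = g-diag i
  ... | tri> i≮j _ j<i rewrite dec-false (i <? j) i≮j | dec-true (j <? i) j<i = ≡.sym (ℕP.+-identityʳ _)
  upper≡lower : ∑² n (λ i j → 𝟙 (j <ᵇ i) ℕ.* g i j) ≡ ∑< n g
  upper≡lower = ≡.trans (∑²-cong n (λ i j → ≡.cong (𝟙 (j <ᵇ i) ℕ.*_) (g-sym i j)))
                        (∑²-transpose n (λ i j → 𝟙 (i <ᵇ j) ℕ.* g i j))

Flips-sym : ∀ {n} (π : Permutation′ n) i j → Flips π i j ≡ Flips π j i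
Flips-sym π i j with i ≟ j
... | yes ≡.refl = ≡.refl
... | no  i≢j    = begin
  (i <ᵇ j) xor (π ⟨$⟩ʳ i <ᵇ π ⟨$⟩ʳ j)         ≡⟨ not-xor-not (i <ᵇ j) (π ⟨$⟩ʳ i <ᵇ π ⟨$⟩ʳ j) ⟨
  not (i <ᵇ j) xor not (π ⟨$⟩ʳ i <ᵇ π ⟨$⟩ʳ j) ≡⟨ ≡.cong₂ _xor_ (<ᵇ-flip i≢j) (<ᵇ-flip (i≢j ∘ ⟨$⟩ʳ-injective π)) ⟨
  (j <ᵇ i) xor (π ⟨$⟩ʳ j <ᵇ π ⟨$⟩ʳ i)         ∎
  where
  open ≡.≡-Reasoning
  not-xor-not : ∀ a b → not a xor not b ≡ a xor b
  not-xor-not true  b = ≡.refl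
  not-xor-not false b = not-involutive b

Flips-diag : ∀ {n} (π : Permutation′ n) i → Flips π i i ≡ false
Flips-diag π i = ≡.cong₂ _xor_ (<ᵇ-irrefl i) (<ᵇ-irrefl (π ⟨$⟩ʳ i))

Flips-∘ : ∀ {n} (σ τ : Permutation′ n) i j →
          Flips (σ ⊙ τ) i j ≡ Flips τ i j xor Flips σ (τ ⟨$⟩ʳ i) (τ ⟨$⟩ʳ j)
Flips-∘ σ τ i j = ≡.sym (xor-cancel-middle (i <ᵇ j) (τ ⟨$⟩ʳ i <ᵇ τ ⟨$⟩ʳ j) _)
  where
  xor-cancel-middle : ∀ a b c → (a xor b) xor (b xor c) ≡ a xor c
  xor-cancel-middle true  true  c = ≡.refl
  xor-cancel-middle false true  c = not-involutive c
  xor-cancel-middle true  false c = ≡.refl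
  xor-cancel-middle false false c = ≡.refl

length≡∑1 : ∀ {a} {A : Set a} (xs : List A) → length xs ≡ ℕΣ.∑ xs (λ _ → 1)
length≡∑1 []       = ≡.refl
length≡∑1 (x ∷ xs) = ≡.cong suc (length≡∑1 xs)

inversions≡∑< : ∀ {n} (π : Permutation′ n) → inversions π ≡ ∑< n (λ i j → 𝟙 (Flips π i j))
inversions≡∑< {n} π = begin
  inversions π
    ≡⟨ length≡∑1 (filter descent? (filter ascent? pairs)) ⟩
  ℕΣ.∑ (filter descent? (filter ascent? pairs)) (λ _ → 1)
    ≡⟨ ℕΣ.∑-filter descent? (filter ascent? pairs) _ ⟩
  ℕΣ.∑ (filter ascent? pairs) (λ ij → if does (descent? ij) then 1 else 0)
    ≡⟨ ℕΣ.∑-filter ascent? pairs _ ⟩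
  ℕΣ.∑ pairs term
    ≡⟨ ℕΣ.∑-cartesianProduct (allFin n) (allFin n) term ⟩
  ∑² n (λ i j → term (i , j))
    ≡⟨ ∑²-cong n term≡ ⟩
  ∑< n (λ i j → 𝟙 (Flips π i j)) ∎
  where
  open ≡.≡-Reasoning
  pairs = cartesianProduct (allFin n) (allFin n)
  ascent? : (ij : Fin n × Fin n) → Dec (proj₁ ij F.< proj₂ ij)
  ascent? ij = proj₁ ij <? proj₂ ij
  descent? : (ij : Fin n × Fin n) → Dec (π ⟨$⟩ʳ proj₂ ij F.< π ⟨$⟩ʳ proj₁ ij)
  descent? ij = π ⟨$⟩ʳ proj₂ ij <? π ⟨$⟩ʳ proj₁ ij
  term : Fin n × Fin n → ℕ
  term ij = if does (ascent? ij) then (if does (descent? ij) then 1 else 0) else 0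
  term≡ : ∀ i j → term (i , j) ≡ 𝟙 (i <ᵇ j) ℕ.* 𝟙 (Flips π i j)
  term≡ i j = shape (i <ᵇ j) (π ⟨$⟩ʳ i <ᵇ π ⟨$⟩ʳ j)
                    (λ i<ᵇj → <ᵇ-flip (<ᵇ⇒≢ i<ᵇj ∘ ⟨$⟩ʳ-injective π))
    where
    shape : ∀ a {b} c → (a ≡ true → b ≡ not c) →
            (if a then (if b then 1 else 0) else 0) ≡ 𝟙 a ℕ.* 𝟙 (a xor c)
    shape false c     _    = ≡.refl
    shape true  true  b≡¬c rewrite b≡¬c ≡.refl = ≡.refl
    shape true  false b≡¬c rewrite b≡¬c ≡.refl = ≡.refl

∑²-Flips≡2*∑< : ∀ {n} (σ : Permutation′ n) (h : Fin n → Fin n) →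
                let g = λ i j → 𝟙 (Flips σ (h i) (h j)) in ∑² n g ≡ 2 ℕ.* ∑< n g
∑²-Flips≡2*∑< {n} σ h =
  ∑²≡2*∑< n _ (λ i j → ≡.cong 𝟙 (Flips-sym σ (h i) (h j))) (λ i → ≡.cong 𝟙 (Flips-diag σ (h i)))

-- Reindexing by τ does not preserve i < j, hence the detour through the full double sum.
∑<-Flips-reindex : ∀ {n} (σ τ : Permutation′ n) →
                   ∑< n (λ i j → 𝟙 (Flips σ (τ ⟨$⟩ʳ i) (τ ⟨$⟩ʳ j))) ≡ ∑< n (λ i j → 𝟙 (Flips σ i j))
∑<-Flips-reindex {n} σ τ = ℕP.*-cancelˡ-≡ _ _ 2 (begin
  2 ℕ.* ∑< n (λ i j → 𝟙 (Flips σ (τ ⟨$⟩ʳ i) (τ ⟨$⟩ʳ j))) ≡⟨ ∑²-Flips≡2*∑< σ (τ ⟨$⟩ʳ_) ⟨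
  ∑² n (λ i j → 𝟙 (Flips σ (τ ⟨$⟩ʳ i) (τ ⟨$⟩ʳ j)))       ≡⟨ ∑²-reindex n τ (λ i j → 𝟙 (Flips σ i j)) ⟩
  ∑² n (λ i j → 𝟙 (Flips σ i j))                         ≡⟨ ∑²-Flips≡2*∑< σ id ⟩
  2 ℕ.* ∑< n (λ i j → 𝟙 (Flips σ i j))                   ∎)
  where open ≡.≡-Reasoning

inversions-∘ : ∀ {n} (σ τ : Permutation′ n) →
               Σ ℕ λ k → inversions (σ ⊙ τ) ℕ.+ 2 ℕ.* k ≡ inversions τ ℕ.+ inversions σ
inversions-∘ {n} σ τ = ∑< n both , (begin
  inversions (σ ⊙ τ) ℕ.+ 2 ℕ.* ∑< n both
    ≡⟨ ≡.cong₂ ℕ._+_ (inversions≡∑< (σ ⊙ τ)) (*-distribˡ-∑² n 2 _) ⟩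
  ∑< n (λ i j → 𝟙 (Flips (σ ⊙ τ) i j)) ℕ.+ ∑² n (λ i j → 2 ℕ.* (𝟙 (i <ᵇ j) ℕ.* both i j))
    ≡⟨ ∑²-distrib-+ n _ _ ⟨
  ∑² n (λ i j → 𝟙 (i <ᵇ j) ℕ.* 𝟙 (Flips (σ ⊙ τ) i j) ℕ.+ 2 ℕ.* (𝟙 (i <ᵇ j) ℕ.* both i j))
    ≡⟨ ∑²-cong n pointwise ⟩
  ∑² n (λ i j → 𝟙 (i <ᵇ j) ℕ.* 𝟙 (Flips τ i j) ℕ.+ 𝟙 (i <ᵇ j) ℕ.* 𝟙 (Flips σ (τ ⟨$⟩ʳ i) (τ ⟨$⟩ʳ j)))
    ≡⟨ ∑²-distrib-+ n _ _ ⟩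
  ∑< n (λ i j → 𝟙 (Flips τ i j)) ℕ.+ ∑< n (λ i j → 𝟙 (Flips σ (τ ⟨$⟩ʳ i) (τ ⟨$⟩ʳ j)))
    ≡⟨ ≡.cong₂ ℕ._+_ (≡.sym (inversions≡∑< τ))
                     (≡.trans (∑<-Flips-reindex σ τ) (≡.sym (inversions≡∑< σ))) ⟩
  inversions τ ℕ.+ inversions σ ∎)
  where
  open ≡.≡-Reasoning
  both : Fin n → Fin n → ℕ
  both i j = 𝟙 (Flips τ i j) ℕ.* 𝟙 (Flips σ (τ ⟨$⟩ʳ i) (τ ⟨$⟩ʳ j))
  xor-count : ∀ a x y →
              𝟙 a ℕ.* 𝟙 (x xor y) ℕ.+ 2 ℕ.* (𝟙 a ℕ.* (𝟙 x ℕ.* 𝟙 y)) ≡ 𝟙 a ℕ.* 𝟙 x ℕ.+ 𝟙 a ℕ.* 𝟙 y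
  xor-count false x     y     = ≡.refl
  xor-count true  true  true  = ≡.refl
  xor-count true  true  false = ≡.refl
  xor-count true  false true  = ≡.refl
  xor-count true  false false = ≡.refl
  pointwise : ∀ i j → 𝟙 (i <ᵇ j) ℕ.* 𝟙 (Flips (σ ⊙ τ) i j) ℕ.+ 2 ℕ.* (𝟙 (i <ᵇ j) ℕ.* both i j)
                    ≡ 𝟙 (i <ᵇ j) ℕ.* 𝟙 (Flips τ i j) ℕ.+ 𝟙 (i <ᵇ j) ℕ.* 𝟙 (Flips σ (τ ⟨$⟩ʳ i) (τ ⟨$⟩ʳ j))
  pointwise i j rewrite Flips-∘ σ τ i j = xor-count (i <ᵇ j) (Flips τ i j) (Flips σ (τ ⟨$⟩ʳ i) (τ ⟨$⟩ʳ j))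

sgn-∘ : ∀ {n} (σ τ : Permutation′ n) → sgn (σ ⊙ τ) ≡ sgn σ ℤ.* sgn τ
sgn-∘ σ τ with inversions-∘ σ τ
... | k , inv[στ]+2k≡inv[τ]+inv[σ] = begin
  -1ℤ ^ inversions (σ ⊙ τ)                   ≡⟨ ℤP.*-identityʳ _ ⟨
  -1ℤ ^ inversions (σ ⊙ τ) ℤ.* 1ℤ            ≡⟨ ≡.cong (-1ℤ ^ inversions (σ ⊙ τ) ℤ.*_) (-1^2k≡1 k) ⟨
  -1ℤ ^ inversions (σ ⊙ τ) ℤ.* -1ℤ ^ (2 ℕ.* k) ≡⟨ ℤP.^-distribˡ-+-* -1ℤ (inversions (σ ⊙ τ)) (2 ℕ.* k) ⟨
  -1ℤ ^ (inversions (σ ⊙ τ) ℕ.+ 2 ℕ.* k)     ≡⟨ ≡.cong (-1ℤ ^_) inv[στ]+2k≡inv[τ]+inv[σ] ⟩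
  -1ℤ ^ (inversions τ ℕ.+ inversions σ)       ≡⟨ ℤP.^-distribˡ-+-* -1ℤ (inversions τ) (inversions σ) ⟩
  sgn τ ℤ.* sgn σ                               ≡⟨ ℤP.*-comm (sgn τ) (sgn σ) ⟩
  sgn σ ℤ.* sgn τ                               ∎
  where
  open ≡.≡-Reasoning
  -1^2k≡1 : ∀ k → -1ℤ ^ (2 ℕ.* k) ≡ 1ℤ
  -1^2k≡1 k = ≡.trans (≡.sym (ℤP.^-*-assoc -1ℤ 2 k)) (ℤP.^-zeroˡ k)

sgn-cong : ∀ {n} {σ τ : Permutation′ n} → σ ≈ₚ τ → sgn σ ≡ sgn τ
sgn-cong {n} {σ} {τ} σ≈τ = ≡.cong (-1ℤ ^_) (begin
  inversions σ                       ≡⟨ inversions≡∑< σ ⟩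
  ∑< n (λ i j → 𝟙 (Flips σ i j))     ≡⟨ ∑²-cong n (λ i j → ≡.cong (λ b → 𝟙 (i <ᵇ j) ℕ.* 𝟙 ((i <ᵇ j) xor b))
                                                                 (≡.cong₂ _<ᵇ_ (σ≈τ i) (σ≈τ j))) ⟩
  ∑< n (λ i j → 𝟙 (Flips τ i j))     ≡⟨ inversions≡∑< τ ⟨
  inversions τ                       ∎)
  where open ≡.≡-Reasoning

sgn-id : ∀ {n} → sgn (P.id {n}) ≡ 1ℤ
sgn-id {n} = ≡.cong (-1ℤ ^_) (begin
  inversions (P.id {n})             ≡⟨ inversions≡∑< (P.id {n}) ⟩
  ∑< n (λ i j → 𝟙 (Flips P.id i j)) ≡⟨ ∑²-cong n no-flips ⟩
  ∑² n (λ _ _ → 0)                  ≡⟨ ≡.trans (ℕΣ.∑-cong (allFin n) (λ _ → ℕΣ.∑-zero (allFin n))) (ℕΣ.∑-zero (allFin n)) ⟩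
  0                                 ∎)
  where
  open ≡.≡-Reasoning
  no-flips : ∀ i j → 𝟙 (i <ᵇ j) ℕ.* 𝟙 (Flips P.id i j) ≡ 0
  no-flips i j rewrite xor-same (i <ᵇ j) = ℕP.*-zeroʳ (𝟙 (i <ᵇ j))

sgn-conj : ∀ {n} (ρ ζ : Permutation′ n) → sgn (ρ ⊙ (ζ ⊙ ρ ⁻¹)) ≡ sgn ζ
sgn-conj {n} ρ ζ = begin
  sgn (ρ ⊙ (ζ ⊙ ρ ⁻¹))                 ≡⟨ ≡.trans (sgn-∘ ρ (ζ ⊙ ρ ⁻¹)) (≡.cong (sgn ρ ℤ.*_) (sgn-∘ ζ (ρ ⁻¹))) ⟩
  sgn ρ ℤ.* (sgn ζ ℤ.* sgn (ρ ⁻¹))     ≡⟨ ≡.cong (sgn ρ ℤ.*_) (ℤP.*-comm (sgn ζ) _) ⟩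
  sgn ρ ℤ.* (sgn (ρ ⁻¹) ℤ.* sgn ζ)     ≡⟨ ℤP.*-assoc (sgn ρ) _ _ ⟨
  sgn ρ ℤ.* sgn (ρ ⁻¹) ℤ.* sgn ζ       ≡⟨ ≡.cong (ℤ._* sgn ζ) sgn[ρρ⁻¹]≡1 ⟩
  1ℤ ℤ.* sgn ζ                         ≡⟨ ℤP.*-identityˡ (sgn ζ) ⟩
  sgn ζ                                ∎
  where
  open ≡.≡-Reasoning
  sgn[ρρ⁻¹]≡1 : sgn ρ ℤ.* sgn (ρ ⁻¹) ≡ 1ℤ
  sgn[ρρ⁻¹]≡1 = ≡.trans (≡.sym (sgn-∘ ρ (ρ ⁻¹)))
                        (≡.trans (sgn-cong {σ = ρ ⊙ ρ ⁻¹} {P.id} (λ _ → P.inverseʳ ρ)) (sgn-id {n}))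

transpose-natural : ∀ {n} (ρ : Permutation′ n) i j →
                    ρ ⊙ P.transpose i j ≈ₚ P.transpose (ρ ⟨$⟩ʳ i) (ρ ⟨$⟩ʳ j) ⊙ ρ
transpose-natural ρ i j k with k ≟ i
... | yes ≡.refl = ≡.sym (transpose-matchˡ (ρ ⟨$⟩ʳ i) (ρ ⟨$⟩ʳ j))
... | no  k≢i with k ≟ j
...   | yes ≡.refl = ≡.sym (transpose-matchʳ (ρ ⟨$⟩ʳ i) (ρ ⟨$⟩ʳ j))
...   | no  k≢j    = ≡.sym (transpose-mismatch (k≢i ∘ ⟨$⟩ʳ-injective ρ) (k≢j ∘ ⟨$⟩ʳ-injective ρ))

sgn-transpose-conj : ∀ {n} (ρ : Permutation′ n) i j → sgn (P.transpose (ρ ⟨$⟩ʳ i) (ρ ⟨$⟩ʳ j)) ≡ sgn (P.transpose i j)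
sgn-transpose-conj ρ i j =
  ≡.trans (sgn-cong {σ = P.transpose (ρ ⟨$⟩ʳ i) (ρ ⟨$⟩ʳ j)} {ρ ⊙ (P.transpose i j ⊙ ρ ⁻¹)} conj)
          (sgn-conj ρ (P.transpose i j))
  where
  conj : P.transpose (ρ ⟨$⟩ʳ i) (ρ ⟨$⟩ʳ j) ≈ₚ ρ ⊙ (P.transpose i j ⊙ ρ ⁻¹)
  conj k = ≡.sym (≡.trans (transpose-natural ρ i j (ρ ⁻¹ ⟨$⟩ʳ k))
                          (≡.cong (PC.transpose (ρ ⟨$⟩ʳ i) (ρ ⟨$⟩ʳ j)) (P.inverseʳ ρ)))

inversions-transpose₀₁ : ∀ m → inversions (P.transpose {2 ℕ.+ m} zero (suc zero)) ≡ 1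
inversions-transpose₀₁ m = begin
  inversions t                                  ≡⟨ inversions≡∑< t ⟩
  ∑² (2 ℕ.+ m) g                                ≡⟨ ∑-allFin-2+ (λ i → ℕΣ.∑ (allFin (2 ℕ.+ m)) (g i)) ⟩
  row zero ℕ.+ (row (suc zero) ℕ.+ ℕΣ.∑ (allFin m) (λ k → row (suc (suc k))))
    ≡⟨ ≡.cong₂ ℕ._+_ row0 (≡.cong₂ ℕ._+_ row1 (≡.trans (ℕΣ.∑-cong (allFin m) row2+) (ℕΣ.∑-zero (allFin m)))) ⟩
  1                                             ∎
  where
  open ≡.≡-Reasoning
  t = P.transpose {2 ℕ.+ m} zero (suc zero)
  g : Fin (2 ℕ.+ m) → Fin (2 ℕ.+ m) → ℕ
  g i j = 𝟙 (i <ᵇ j) ℕ.* 𝟙 (Flips t i j)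
  row : Fin (2 ℕ.+ m) → ℕ
  row i = ℕΣ.∑ (allFin (2 ℕ.+ m)) (g i)
  ∑-allFin-2+ : (f : Fin (2 ℕ.+ m) → ℕ) →
                ℕΣ.∑ (allFin (2 ℕ.+ m)) f ≡ f zero ℕ.+ (f (suc zero) ℕ.+ ℕΣ.∑ (allFin m) (λ k → f (suc (suc k))))
  ∑-allFin-2+ f = ≡.trans (ℕΣ.∑-allFin-suc f) (≡.cong (f zero ℕ.+_) (ℕΣ.∑-allFin-suc (f ∘ suc)))
  row0 : row zero ≡ 1
  row0 = ≡.trans (∑-allFin-2+ (g zero)) (≡.cong suc (ℕΣ.∑-zero (allFin m)))
  row1 : row (suc zero) ≡ 0
  row1 = ≡.trans (∑-allFin-2+ (g (suc zero))) (ℕΣ.∑-zero (allFin m))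
  row2+ : ∀ k → row (suc (suc k)) ≡ 0
  row2+ k = ≡.trans (∑-allFin-2+ (g (suc (suc k)))) (≡.trans (ℕΣ.∑-cong (allFin m) fixed) (ℕΣ.∑-zero (allFin m)))
    where
    fixed : ∀ l → g (suc (suc k)) (suc (suc l)) ≡ 0
    fixed l rewrite xor-same (suc (suc k) <ᵇ suc (suc l)) = ℕP.*-zeroʳ (𝟙 (suc (suc k) <ᵇ suc (suc l)))

sgn-transpose : ∀ {n} {i j : Fin n} → i ≢ j → sgn (P.transpose i j) ≡ -1ℤ
sgn-transpose {1} {zero} {zero} 0≢0 = ⊥-elim (0≢0 ≡.refl)
sgn-transpose {suc (suc m)} {i} {j} i≢j = begin
  sgn (P.transpose i j)
    ≡⟨ sgn-transpose-conj ρ₁ i j ⟨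
  sgn (P.transpose (ρ₁ ⟨$⟩ʳ i) j′)
    ≡⟨ ≡.cong (λ x → sgn (P.transpose x j′)) (transpose-matchʳ zero i) ⟩
  sgn (P.transpose zero j′)
    ≡⟨ sgn-transpose-conj ρ₂ zero j′ ⟨
  sgn (P.transpose (ρ₂ ⟨$⟩ʳ zero) (ρ₂ ⟨$⟩ʳ j′))
    ≡⟨ ≡.cong₂ (λ x y → sgn (P.transpose x y)) ρ₂0≡0 (transpose-matchʳ (suc zero) j′) ⟩
  sgn (P.transpose {2 ℕ.+ m} zero (suc zero))
    ≡⟨ ≡.cong (-1ℤ ^_) (inversions-transpose₀₁ m) ⟩
  -1ℤ ∎
  where
  open ≡.≡-Reasoning
  ρ₁ = P.transpose zero i
  j′ = ρ₁ ⟨$⟩ʳ j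
  ρ₂ = P.transpose (suc zero) j′
  j′≢0 : j′ ≢ zero
  j′≢0 j′≡0 = i≢j (⟨$⟩ʳ-injective ρ₁ (≡.trans (transpose-matchʳ zero i) (≡.sym j′≡0)))
  ρ₂0≡0 : ρ₂ ⟨$⟩ʳ zero ≡ zero
  ρ₂0≡0 = transpose-mismatch {i = suc zero} {j′} (λ ()) (j′≢0 ∘ ≡.sym)

-- Coefficients in the group algebra

χ : ∀ {a p} {A : Set a} {P : A → Set p} → Decidable P → A → ℤ
χ P? x = if does (P? x) then 1ℤ else 0ℤ

χ-⇔ : ∀ {a b p q} {A : Set a} {B : Set b} {P : A → Set p} {Q : B → Set q} (P? : Decidable P) (Q? : Decidable Q) {x y} →
      P x ⇔ Q y → χ P? x ≡ χ Q? y
χ-⇔ P? Q? {x} {y} Px⇔Qy = ≡.cong (λ b → if b then 1ℤ else 0ℤ) (does-⇔ Px⇔Qy (P? x) (Q? y))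

if-then-0≡χ* : ∀ {a p} {A : Set a} {P : A → Set p} (P? : Decidable P) x r → (if does (P? x) then r else 0ℤ) ≡ χ P? x ℤ.* r
if-then-0≡χ* P? x r with does (P? x)
... | true  = ≡.sym (ℤP.*-identityˡ r)
... | false = ≡.refl

δₚ : ∀ {n} → Permutation′ n → Permutation′ n → ℤ
δₚ = ℤΣ.δ _≈ₚ?_

coeff-∷ : ∀ {n} c (p : Permutation′ n) xs g → coeff ((c , p) ∷ xs) g ≡ c ℤ.* δₚ p g ℤ.+ coeff xs g
coeff-∷ c p xs g with p ≈ₚ? g
... | yes p≈g rewrite ℤΣ.δ-~ _≈ₚ?_ {p} {g} p≈g = ≡.cong (ℤ._+ coeff xs g) (≡.sym (ℤP.*-identityʳ c))
... | no  p≉g rewrite ℤΣ.δ-≁ _≈ₚ?_ {p} {g} p≉g | ℤP.*-zeroʳ c = ≡.sym (ℤP.+-identityˡ (coeff xs g))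

coeff≡∑ : ∀ {n} (x : GA n) g → coeff x g ≡ ℤΣ.∑ x (λ cp → proj₁ cp ℤ.* δₚ (proj₂ cp) g)
coeff≡∑ []             g = ≡.refl
coeff≡∑ ((c , p) ∷ xs) g = ≡.trans (coeff-∷ c p xs g) (≡.cong (ℤ._+_ (c ℤ.* δₚ p g)) (coeff≡∑ xs g))

δₚ-∘ : ∀ {n} (p q g : Permutation′ n) → δₚ (p ⊙ q) g ≡ δₚ q (p ⁻¹ ⊙ g)
δₚ-∘ p q g = ℤΣ.δ-⇔ _≈ₚ?_ _≈ₚ?_ {p ⊙ q} {g} {q} {p ⁻¹ ⊙ g} (mk⇔
  (λ pq≈g k → ≡.trans (≡.sym (P.inverseˡ p)) (≡.cong (p ⁻¹ ⟨$⟩ʳ_) (pq≈g k)))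
  (λ q≈p⁻¹g k → ≡.trans (≡.cong (p ⟨$⟩ʳ_) (q≈p⁻¹g k)) (P.inverseʳ p)))

coeff-* : ∀ {n} (x y : GA n) g → coeff (x * y) g ≡ ℤΣ.∑ x (λ cp → proj₁ cp ℤ.* coeff y (proj₂ cp ⁻¹ ⊙ g))
coeff-* x y g = begin
  coeff (x * y) g                 ≡⟨ coeff≡∑ (x * y) g ⟩
  ℤΣ.∑ (x * y) term                ≡⟨ ℤΣ.∑-concatMap (λ cp → map (product cp) y) x term ⟩
  ℤΣ.∑ x (λ cp → ℤΣ.∑ (map (product cp) y) term) ≡⟨ ℤΣ.∑-cong x row ⟩
  ℤΣ.∑ x (λ cp → proj₁ cp ℤ.* coeff y (proj₂ cp ⁻¹ ⊙ g)) ∎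
  where
  open ≡.≡-Reasoning
  term : ℤ × Permutation′ _ → ℤ
  term cp = proj₁ cp ℤ.* δₚ (proj₂ cp) g
  product : ℤ × Permutation′ _ → ℤ × Permutation′ _ → ℤ × Permutation′ _
  product (c , p) (d , q) = c ℤ.* d , p ⊙ q
  row : ∀ cp → ℤΣ.∑ (map (product cp) y) term ≡ proj₁ cp ℤ.* coeff y (proj₂ cp ⁻¹ ⊙ g)
  row (c , p) = begin
    ℤΣ.∑ (map (product (c , p)) y) term                           ≡⟨ ℤΣ.∑-map (product (c , p)) y term ⟩
    ℤΣ.∑ y (λ dq → c ℤ.* proj₁ dq ℤ.* δₚ (p ⊙ proj₂ dq) g)         ≡⟨ ℤΣ.∑-cong y shift ⟩
    ℤΣ.∑ y (λ dq → c ℤ.* (proj₁ dq ℤ.* δₚ (proj₂ dq) (p ⁻¹ ⊙ g))) ≡⟨ ℤΣ.*-distribˡ-∑ y c _ ⟨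
    c ℤ.* ℤΣ.∑ y (λ dq → proj₁ dq ℤ.* δₚ (proj₂ dq) (p ⁻¹ ⊙ g))   ≡⟨ ≡.cong (c ℤ.*_) (coeff≡∑ y (p ⁻¹ ⊙ g)) ⟨
    c ℤ.* coeff y (p ⁻¹ ⊙ g)                                      ∎
    where
    shift : ∀ dq → c ℤ.* proj₁ dq ℤ.* δₚ (p ⊙ proj₂ dq) g ≡ c ℤ.* (proj₁ dq ℤ.* δₚ (proj₂ dq) (p ⁻¹ ⊙ g))
    shift (d , q) rewrite δₚ-∘ p q g = ℤP.*-assoc c d _

∑-[]* : ∀ {n} (s : Permutation′ n) (x : GA n) f → ℤΣ.∑ ([ s ] * x) f ≡ ℤΣ.∑ x (λ dq → f (1ℤ ℤ.* proj₁ dq , s ⊙ proj₂ dq))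
∑-[]* s x f = ≡.trans (ℤΣ.∑-concatMap (λ cp → map (λ dq → proj₁ cp ℤ.* proj₁ dq , proj₂ cp ⊙ proj₂ dq) x) ((1ℤ , s) ∷ []) f)
                      (≡.trans (ℤP.+-identityʳ _) (ℤΣ.∑-map _ x f))

coeff-• : ∀ {n} c (x : GA n) g → coeff (c • x) g ≡ c ℤ.* coeff x g
coeff-• c x g = begin
  coeff (c • x) g                                          ≡⟨ coeff≡∑ (c • x) g ⟩
  ℤΣ.∑ (c • x) (λ cp → proj₁ cp ℤ.* δₚ (proj₂ cp) g)        ≡⟨ ℤΣ.∑-map _ x _ ⟩
  ℤΣ.∑ x (λ cp → c ℤ.* proj₁ cp ℤ.* δₚ (proj₂ cp) g)        ≡⟨ ℤΣ.∑-cong x (λ cp → ℤP.*-assoc c _ _) ⟩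
  ℤΣ.∑ x (λ cp → c ℤ.* (proj₁ cp ℤ.* δₚ (proj₂ cp) g))      ≡⟨ ℤΣ.*-distribˡ-∑ x c _ ⟨
  c ℤ.* ℤΣ.∑ x (λ cp → proj₁ cp ℤ.* δₚ (proj₂ cp) g)        ≡⟨ ≡.cong (c ℤ.*_) (coeff≡∑ x g) ⟨
  c ℤ.* coeff x g                                          ∎
  where open ≡.≡-Reasoning

χ-resp : ∀ {n p} {P : Permutation′ n → Set p} (P? : Decidable P) → P Respects _≈ₚ_ →
         χ P? Preserves _≈ₚ_ ⟶ _≡_
χ-resp P? resp {p} {q} p≈q = χ-⇔ P? P? (mk⇔ (resp p≈q) (resp (≈ₚ-sym {x = p} {q} p≈q)))

coeff-∑-subset : ∀ {n p} {P : Permutation′ n → Set p} (P? : Decidable P) → P Respects _≈ₚ_ →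
                 ∀ g → coeff (map (λ π → (1ℤ , π)) (filter P? (allPerms n))) g ≡ χ P? g
coeff-∑-subset {n} P? resp g = begin
  coeff subset g
    ≡⟨ coeff≡∑ subset g ⟩
  ℤΣ.∑ subset (λ cp → proj₁ cp ℤ.* δₚ (proj₂ cp) g)
    ≡⟨ ℤΣ.∑-map _ (filter P? (allPerms n)) _ ⟩
  ℤΣ.∑ (filter P? (allPerms n)) (λ π → 1ℤ ℤ.* δₚ π g)
    ≡⟨ ℤΣ.∑-filter P? (allPerms n) _ ⟩
  ℤΣ.∑ (allPerms n) (λ π → if does (P? π) then 1ℤ ℤ.* δₚ π g else 0ℤ)
    ≡⟨ ℤΣ.∑-cong (allPerms n) (λ π → ≡.trans (if-then-0≡χ* P? π _) (≡.cong (χ P? π ℤ.*_) (ℤP.*-identityˡ (δₚ π g)))) ⟩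
  ℤΣ.∑ (allPerms n) (λ π → χ P? π ℤ.* δₚ π g)
    ≡⟨ ℤΣ.∑-δ _≈ₚ?_ {allPerms n} (ℤPerm.allPerms-enumerates n) {χ P?} (χ-resp P? resp) g ⟩
  χ P? g ∎
  where
  open ≡.≡-Reasoning
  subset = map (λ π → (1ℤ , π)) (filter P? (allPerms n))

-- Relabelled numberings

Stable : ∀ {b n} {B : Set b} → (Fin n → B) → Permutation′ n → Set b
Stable r x = ∀ k → r (x ⟨$⟩ʳ k) ≡ r k

module _ {b} {n : ℕ} {B : Set b} where

  Stable-cong : ∀ {c} {C : Set c} {r : Fin n → B} {r′ : Fin n → C} (f : B → C) → (∀ {u w} → f u ≡ f w → u ≡ w) →
                (∀ k → r′ k ≡ f (r k)) → ∀ x → Stable r′ x ⇔ Stable r x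
  Stable-cong f f-inj r′≡fr x = mk⇔
    (λ st k → f-inj (≡.trans (≡.sym (r′≡fr (x ⟨$⟩ʳ k))) (≡.trans (st k) (r′≡fr k))))
    (λ st k → ≡.trans (r′≡fr (x ⟨$⟩ʳ k)) (≡.trans (≡.cong f (st k)) (≡.sym (r′≡fr k))))

  Stable-≗ : ∀ {r r′ : Fin n → B} → (∀ k → r′ k ≡ r k) → ∀ x → Stable r′ x ⇔ Stable r x
  Stable-≗ = Stable-cong id id

  Stable-∘ˡ : ∀ {r : Fin n → B} {π} → Stable r π → ∀ x → Stable r (π ⊙ x) ⇔ Stable r x
  Stable-∘ˡ π-st x = mk⇔ (λ st k → ≡.trans (≡.sym (π-st (x ⟨$⟩ʳ k))) (st k))
                         (λ st k → ≡.trans (π-st (x ⟨$⟩ʳ k)) (st k))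

  Stable-conj : ∀ (r : Fin n → B) π ζ → Stable (r ∘ (π ⁻¹ ⟨$⟩ʳ_)) (π ⊙ (ζ ⊙ π ⁻¹)) ⇔ Stable r ζ
  Stable-conj r π ζ = mk⇔
    (λ st k → ≡.trans (≡.cong (λ j → r (ζ ⟨$⟩ʳ j)) (≡.sym (P.inverseˡ π)))
              (≡.trans (≡.sym (≡.cong r (P.inverseˡ π))) (≡.trans (st (π ⟨$⟩ʳ k)) (≡.cong r (P.inverseˡ π)))))
    (λ st k → ≡.trans (≡.cong r (P.inverseˡ π)) (st (π ⁻¹ ⟨$⟩ʳ k)))

module _ {sh n} (T : Numbering sh n) where

  InR-resp : InR T Respects _≈ₚ_
  InR-resp p≈q p∈R k = ≡.trans (≡.cong (rowOf T) (≡.sym (p≈q k))) (p∈R k)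

  InC-resp : InC T Respects _≈ₚ_
  InC-resp p≈q p∈C k = ≡.trans (≡.cong (colOf T) (≡.sym (p≈q k))) (p∈C k)

  χ-InR-resp : χ (InR? T) Preserves _≈ₚ_ ⟶ _≡_
  χ-InR-resp {p} {q} = χ-resp (InR? T) (λ {x} {y} → InR-resp {x} {y}) {p} {q}

  χ-InC-resp : χ (InC? T) Preserves _≈ₚ_ ⟶ _≡_
  χ-InC-resp {p} {q} = χ-resp (InC? T) (λ {x} {y} → InC-resp {x} {y}) {p} {q}

  coeff-a : ∀ g → coeff (a T) g ≡ χ (InR? T) g
  coeff-a = coeff-∑-subset (InR? T) (λ {p} {q} → InR-resp {p} {q})

  vSummand : Permutation′ n → Permutation′ n → Permutation′ n → ℤ
  vSummand s g ζ = χ (InC? T) ζ ℤ.* (sgn ζ ℤ.* χ (InR? T) ((s ⊙ ζ) ⁻¹ ⊙ g))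

  coeff-v : ∀ S g → coeff (v T S) g ≡ ℤΣ.∑ (allPerms n) (vSummand (σ T S) g)
  coeff-v S g = begin
    coeff ([ s ] * b T * a T) g
      ≡⟨ coeff-* ([ s ] * b T) (a T) g ⟩
    ℤΣ.∑ ([ s ] * b T) (λ cp → proj₁ cp ℤ.* coeff (a T) (proj₂ cp ⁻¹ ⊙ g))
      ≡⟨ ℤΣ.∑-cong ([ s ] * b T) (λ cp → ≡.cong (proj₁ cp ℤ.*_) (coeff-a (proj₂ cp ⁻¹ ⊙ g))) ⟩
    ℤΣ.∑ ([ s ] * b T) (λ cp → proj₁ cp ℤ.* χ (InR? T) (proj₂ cp ⁻¹ ⊙ g))
      ≡⟨ ∑-[]* s (b T) _ ⟩
    ℤΣ.∑ (b T) (λ dq → 1ℤ ℤ.* proj₁ dq ℤ.* χ (InR? T) ((s ⊙ proj₂ dq) ⁻¹ ⊙ g))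
      ≡⟨ ℤΣ.∑-map _ (filter (InC? T) (allPerms n)) _ ⟩
    ℤΣ.∑ (filter (InC? T) (allPerms n)) (λ ζ → 1ℤ ℤ.* sgn ζ ℤ.* χ (InR? T) ((s ⊙ ζ) ⁻¹ ⊙ g))
      ≡⟨ ℤΣ.∑-filter (InC? T) (allPerms n) _ ⟩
    ℤΣ.∑ (allPerms n) (λ ζ → if does (InC? T ζ) then 1ℤ ℤ.* sgn ζ ℤ.* χ (InR? T) ((s ⊙ ζ) ⁻¹ ⊙ g) else 0ℤ)
      ≡⟨ ℤΣ.∑-cong (allPerms n) summand ⟩
    ℤΣ.∑ (allPerms n) (vSummand s g) ∎
    where
    open ≡.≡-Reasoning
    s = σ T S
    summand : ∀ ζ → (if does (InC? T ζ) then 1ℤ ℤ.* sgn ζ ℤ.* χ (InR? T) ((s ⊙ ζ) ⁻¹ ⊙ g) else 0ℤ) ≡ vSummand s g ζ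
    summand ζ rewrite ℤP.*-identityˡ (sgn ζ) = if-then-0≡χ* (InC? T) ζ _

  vSummand-resp : ∀ s g → vSummand s g Preserves _≈ₚ_ ⟶ _≡_
  vSummand-resp s g {ζ} {ζ′} ζ≈ζ′ =
    ≡.cong₂ ℤ._*_ (χ-InC-resp {ζ} {ζ′} ζ≈ζ′)
                  (≡.cong₂ ℤ._*_ (sgn-cong {σ = ζ} {ζ′} ζ≈ζ′) (χ-InR-resp {(s ⊙ ζ) ⁻¹ ⊙ g} {(s ⊙ ζ′) ⁻¹ ⊙ g} ζ⁻¹≈ζ′⁻¹))
    where
    ζ⁻¹≈ζ′⁻¹ : (s ⊙ ζ) ⁻¹ ⊙ g ≈ₚ (s ⊙ ζ′) ⁻¹ ⊙ g
    ζ⁻¹≈ζ′⁻¹ k = ⁻¹-cong {π = ζ} {ζ′} ζ≈ζ′ (s ⁻¹ ⟨$⟩ʳ (g ⟨$⟩ʳ k))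

module Relabelling {sh n} {T U : Numbering sh n} {π : Permutation′ n} (U≡π·T : ∀ c → entry U c ≡ entry (π · T) c) where

  from-U : ∀ k → Inverse.from (bij U) k ≡ Inverse.from (bij T) (π ⁻¹ ⟨$⟩ʳ k)
  from-U k = begin
    Inverse.from (bij U) k           ≡⟨ ≡.cong (Inverse.from (bij U)) entry-U ⟨
    Inverse.from (bij U) (entry U c) ≡⟨ Inverse.strictlyInverseʳ (bij U) c ⟩
    c                                ∎
    where
    open ≡.≡-Reasoning
    c = Inverse.from (bij T) (π ⁻¹ ⟨$⟩ʳ k)
    entry-U : entry U c ≡ k
    entry-U = ≡.trans (U≡π·T c) (≡.trans (≡.cong (π ⟨$⟩ʳ_) (Inverse.strictlyInverseˡ (bij T) _)) (P.inverseʳ π))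

  rowOf-U : ∀ k → rowOf U k ≡ rowOf T (π ⁻¹ ⟨$⟩ʳ k)
  rowOf-U k = ≡.cong proj₁ (from-U k)

  colOf-U : ∀ k → colOf U k ≡ colOf T (π ⁻¹ ⟨$⟩ʳ k)
  colOf-U k = ≡.cong (proj₁ ∘ proj₂) (from-U k)

  σ⁻¹-U : ∀ S → π ⁻¹ ⊙ σ U S ⁻¹ ≈ₚ σ T S ⁻¹
  σ⁻¹-U S k = ≡.trans (≡.cong (π ⁻¹ ⟨$⟩ʳ_) (U≡π·T _)) (P.inverseˡ π)

v-relabel-within-rows : ∀ {sh n} (S T U : Numbering sh n) (π : Permutation′ n) → InR T π →
                        (∀ c → entry U c ≡ entry (π · T) c) → v U S ≈ v T S
v-relabel-within-rows {n = n} S T U π π∈R U≡π·T g = begin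
  coeff (v U S) g
    ≡⟨ coeff-v U S g ⟩
  ℤΣ.∑ (allPerms n) (vSummand U (σ U S) g)
    ≡⟨ ℤPerm.∑-translate {f = vSummand U (σ U S) g} (λ {p} {q} → vSummand-resp U (σ U S) g {p} {q}) π (π ⁻¹) ⟨
  ℤΣ.∑ (allPerms n) (λ ζ → vSummand U (σ U S) g (π ⊙ (ζ ⊙ π ⁻¹)))
    ≡⟨ ℤΣ.∑-cong (allPerms n) term ⟩
  ℤΣ.∑ (allPerms n) (vSummand T (σ T S) g)
    ≡⟨ coeff-v T S g ⟨
  coeff (v T S) g ∎
  where
  open ≡.≡-Reasoning
  open Relabelling {T = T} {U} {π} U≡π·T
  rowOf-U≡rowOf-T : ∀ k → rowOf U k ≡ rowOf T k
  rowOf-U≡rowOf-T k =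
    ≡.trans (rowOf-U k) (≡.trans (≡.sym (π∈R (π ⁻¹ ⟨$⟩ʳ k))) (≡.cong (rowOf T) (P.inverseʳ π)))
  term : ∀ ζ → vSummand U (σ U S) g (π ⊙ (ζ ⊙ π ⁻¹)) ≡ vSummand T (σ T S) g ζ
  term ζ = ≡.cong₂ ℤ._*_ χC (≡.cong₂ ℤ._*_ (sgn-conj π ζ) χR)
    where
    χC : χ (InC? U) (π ⊙ (ζ ⊙ π ⁻¹)) ≡ χ (InC? T) ζ
    χC = χ-⇔ (InC? U) (InC? T) {π ⊙ (ζ ⊙ π ⁻¹)} {ζ}
             (Stable-conj (colOf T) π ζ ⇔-∘ Stable-≗ colOf-U (π ⊙ (ζ ⊙ π ⁻¹)))
    x = (σ T S ⊙ ζ) ⁻¹ ⊙ g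
    xU = (σ U S ⊙ (π ⊙ (ζ ⊙ π ⁻¹))) ⁻¹ ⊙ g
    χR : χ (InR? U) xU ≡ χ (InR? T) x
    χR = begin
      χ (InR? U) xU      ≡⟨ χ-⇔ (InR? U) (InR? T) {xU} {xU} (Stable-≗ rowOf-U≡rowOf-T xU) ⟩
      χ (InR? T) xU
        ≡⟨ χ-InR-resp T {xU} {π ⊙ x} (λ k → ≡.cong (λ y → π ⟨$⟩ʳ (ζ ⁻¹ ⟨$⟩ʳ y)) (σ⁻¹-U S (g ⟨$⟩ʳ k))) ⟩
      χ (InR? T) (π ⊙ x)
        ≡⟨ χ-⇔ (InR? T) (InR? T) {π ⊙ x} {x} (Stable-∘ˡ {π = π} π∈R x) ⟩
      χ (InR? T) x ∎

-- Swapping two rows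

swapRow≡transpose : ∀ {m} (i j k : Fin m) → swapRow i j k ≡ PC.transpose i j k
swapRow≡transpose i j k with does (k ≟ i)
... | true  = ≡.refl
... | false with does (k ≟ j)
...   | true  = ≡.refl
...   | false = ≡.refl

transpose-involutive : ∀ {m} (i j k : Fin m) → PC.transpose i j (PC.transpose i j k) ≡ k
transpose-involutive i j k = by (k ≟ i) (k ≟ j)
  where
  t = PC.transpose i j
  by : Dec (k ≡ i) → Dec (k ≡ j) → t (t k) ≡ k
  by (yes k≡i) _ rewrite k≡i         = ≡.trans (≡.cong t (transpose-matchˡ i j)) (transpose-matchʳ i j)
  by (no _)    (yes k≡j) rewrite k≡j = ≡.trans (≡.cong t (transpose-matchʳ i j)) (transpose-matchˡ i j)
  by (no k≢i)  (no k≢j)              = ≡.trans (≡.cong t (transpose-mismatch k≢i k≢j)) (transpose-mismatch k≢i k≢j)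

cell-≡ : ∀ {sh} {c d : Cell sh} → rowOfCell sh c ≡ rowOfCell sh d → colOfCell sh c ≡ colOfCell sh d → c ≡ d
cell-≡ {c = i , j , j<λᵢ} {.i , .j , j<λᵢ′} ≡.refl ≡.refl = ≡.cong (λ p → i , j , p) (ℕP.<-irrelevant j<λᵢ j<λᵢ′)

module RowSwap {sh n} (T : Numbering sh n) {r₁ r₂ : Fin (length sh)} (r₁≢r₂ : r₁ ≢ r₂) {ℓ : ℕ}
               (λr₁≡ℓ : lookup sh r₁ ≡ ℓ) (λr₂≡ℓ : lookup sh r₂ ≡ ℓ) where

  sw : Fin (length sh) → Fin (length sh)
  sw = swapRow r₁ r₂

  sw-r₁ : sw r₁ ≡ r₂
  sw-r₁ = ≡.trans (swapRow≡transpose r₁ r₂ r₁) (transpose-matchˡ r₁ r₂)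

  sw-r₂ : sw r₂ ≡ r₁
  sw-r₂ = ≡.trans (swapRow≡transpose r₁ r₂ r₂) (transpose-matchʳ r₁ r₂)

  sw-other : ∀ {i} → i ≢ r₁ → i ≢ r₂ → sw i ≡ i
  sw-other {i} i≢r₁ i≢r₂ = ≡.trans (swapRow≡transpose r₁ r₂ i) (transpose-mismatch i≢r₁ i≢r₂)

  sw-involutive : ∀ i → sw (sw i) ≡ i
  sw-involutive i rewrite swapRow≡transpose r₁ r₂ i | swapRow≡transpose r₁ r₂ (PC.transpose r₁ r₂ i) =
    transpose-involutive r₁ r₂ i

  sw-injective : ∀ {i j} → sw i ≡ sw j → i ≡ j
  sw-injective {i} {j} swi≡swj = ≡.trans (≡.sym (sw-involutive i)) (≡.trans (≡.cong sw swi≡swj) (sw-involutive j))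

  lookup-sw : ∀ i → lookup sh (sw i) ≡ lookup sh i
  lookup-sw i = by (i ≟ r₁) (i ≟ r₂)
    where
    by : Dec (i ≡ r₁) → Dec (i ≡ r₂) → lookup sh (sw i) ≡ lookup sh i
    by (yes ≡.refl) _           = ≡.trans (≡.cong (lookup sh) sw-r₁) (≡.trans λr₂≡ℓ (≡.sym λr₁≡ℓ))
    by (no _)       (yes ≡.refl) = ≡.trans (≡.cong (lookup sh) sw-r₂) (≡.trans λr₁≡ℓ (≡.sym λr₂≡ℓ))
    by (no i≢r₁)    (no i≢r₂)    = ≡.cong (lookup sh) (sw-other i≢r₁ i≢r₂)

  swapCell : Cell sh → Cell sh
  swapCell (i , j , j<λᵢ) = sw i , j , ≡.subst (j ℕ.<_) (≡.sym (lookup-sw i)) j<λᵢ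

  private
    cellOf : Fin n → Cell sh
    cellOf = Inverse.from (bij T)

    cellOf-entry : ∀ c → cellOf (entry T c) ≡ c
    cellOf-entry = Inverse.strictlyInverseʳ (bij T)

    entry-cellOf : ∀ k → entry T (cellOf k) ≡ k
    entry-cellOf = Inverse.strictlyInverseˡ (bij T)

  τ-fun : Fin n → Fin n
  τ-fun k = entry T (swapCell (cellOf k))

  τ-fun-involutive : ∀ k → τ-fun (τ-fun k) ≡ k
  τ-fun-involutive k = ≡.trans (≡.cong (entry T ∘ swapCell) (cellOf-entry _))
                               (≡.trans (≡.cong (entry T) (cell-≡ {sh} (sw-involutive _) ≡.refl)) (entry-cellOf k))

  τ : Permutation′ n
  τ = P.permutation τ-fun τ-fun τ-fun-involutive τ-fun-involutive

  rowOf-τ : ∀ k → rowOf T (τ ⟨$⟩ʳ k) ≡ sw (rowOf T k)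
  rowOf-τ k = ≡.cong proj₁ (cellOf-entry _)

  colOf-τ : ∀ k → colOf T (τ ⟨$⟩ʳ k) ≡ colOf T k
  colOf-τ k = ≡.cong (proj₁ ∘ proj₂) (cellOf-entry _)

  U≡τ·T : ∀ {U : Numbering sh n} →
          (∀ c d → rowOfCell sh d ≡ swapRow r₁ r₂ (rowOfCell sh c) → colOfCell sh d ≡ colOfCell sh c →
                   entry U c ≡ entry T d) →
          ∀ c → entry U c ≡ entry (τ · T) c
  U≡τ·T U-swap c =
    ≡.trans (U-swap c (swapCell c) ≡.refl ≡.refl) (≡.cong (entry T ∘ swapCell) (≡.sym (cellOf-entry c)))

  cellAt : ∀ {r} → lookup sh r ≡ ℓ → ∀ j → j ℕ.< ℓ → Cell sh
  cellAt {r} λr≡ℓ j j<ℓ = r , j , ≡.subst (j ℕ.<_) (≡.sym λr≡ℓ) j<ℓ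

  top bottom : ∀ j → j ℕ.< ℓ → Fin n
  top    j j<ℓ = entry T (cellAt λr₁≡ℓ j j<ℓ)
  bottom j j<ℓ = entry T (cellAt λr₂≡ℓ j j<ℓ)

  module _ {j} (j<ℓ : j ℕ.< ℓ) where

    rowOf-top : rowOf T (top j j<ℓ) ≡ r₁
    rowOf-top = ≡.cong proj₁ (cellOf-entry _)

    rowOf-bottom : rowOf T (bottom j j<ℓ) ≡ r₂
    rowOf-bottom = ≡.cong proj₁ (cellOf-entry _)

    colOf-top : colOf T (top j j<ℓ) ≡ j
    colOf-top = ≡.cong (proj₁ ∘ proj₂) (cellOf-entry _)

    colOf-bottom : colOf T (bottom j j<ℓ) ≡ j
    colOf-bottom = ≡.cong (proj₁ ∘ proj₂) (cellOf-entry _)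

    top≢bottom : top j j<ℓ ≢ bottom j j<ℓ
    top≢bottom top≡bottom = r₁≢r₂ (≡.trans (≡.sym rowOf-top) (≡.trans (≡.cong (rowOf T) top≡bottom) rowOf-bottom))

    ≢top : ∀ {k} → colOf T k ≢ j → k ≢ top j j<ℓ
    ≢top col≢j k≡top = col≢j (≡.trans (≡.cong (colOf T) k≡top) colOf-top)

    ≢bottom : ∀ {k} → colOf T k ≢ j → k ≢ bottom j j<ℓ
    ≢bottom col≢j k≡bottom = col≢j (≡.trans (≡.cong (colOf T) k≡bottom) colOf-bottom)

    top-unique : ∀ {k} → rowOf T k ≡ r₁ → colOf T k ≡ j → k ≡ top j j<ℓ
    top-unique {k} row≡r₁ col≡j = ≡.trans (≡.sym (entry-cellOf k)) (≡.cong (entry T) (cell-≡ {sh} row≡r₁ col≡j))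

    bottom-unique : ∀ {k} → rowOf T k ≡ r₂ → colOf T k ≡ j → k ≡ bottom j j<ℓ
    bottom-unique {k} row≡r₂ col≡j = ≡.trans (≡.sym (entry-cellOf k)) (≡.cong (entry T) (cell-≡ {sh} row≡r₂ col≡j))

    τ-top : τ ⟨$⟩ʳ top j j<ℓ ≡ bottom j j<ℓ
    τ-top = ≡.cong (entry T) (cell-≡ {sh} (≡.trans (≡.cong sw rowOf-top) sw-r₁) colOf-top)

    τ-bottom : τ ⟨$⟩ʳ bottom j j<ℓ ≡ top j j<ℓ
    τ-bottom = ≡.cong (entry T) (cell-≡ {sh} (≡.trans (≡.cong sw rowOf-bottom) sw-r₂) colOf-bottom)

  τ-other : ∀ {k} → rowOf T k ≢ r₁ → rowOf T k ≢ r₂ → τ ⟨$⟩ʳ k ≡ k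
  τ-other {k} ≢r₁ ≢r₂ = ≡.trans (≡.cong (entry T) (cell-≡ {sh} (sw-other ≢r₁ ≢r₂) ≡.refl)) (entry-cellOf k)

  τ-prefix : ∀ m → m ℕ.≤ ℓ → Permutation′ n
  τ-prefix zero    _   = P.id
  τ-prefix (suc m) m<ℓ = P.transpose (top m m<ℓ) (bottom m m<ℓ) ⊙ τ-prefix m (ℕP.<⇒≤ m<ℓ)

  sgn-τ-prefix : ∀ m m≤ℓ → sgn (τ-prefix m m≤ℓ) ≡ -1ℤ ^ m
  sgn-τ-prefix zero    _   = sgn-id {n}
  sgn-τ-prefix (suc m) m<ℓ =
    ≡.trans (sgn-∘ (P.transpose (top m m<ℓ) (bottom m m<ℓ)) (τ-prefix m (ℕP.<⇒≤ m<ℓ)))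
            (≡.cong₂ ℤ._*_ (sgn-transpose (top≢bottom m<ℓ)) (sgn-τ-prefix m (ℕP.<⇒≤ m<ℓ)))

  τ-prefix-fixes : ∀ m m≤ℓ k → m ℕ.≤ colOf T k → τ-prefix m m≤ℓ ⟨$⟩ʳ k ≡ k
  τ-prefix-fixes zero    _   k _      = ≡.refl
  τ-prefix-fixes (suc m) m<ℓ k m<col =
    ≡.trans (≡.cong (PC.transpose (top m m<ℓ) (bottom m m<ℓ)) (τ-prefix-fixes m (ℕP.<⇒≤ m<ℓ) k (ℕP.<⇒≤ m<col)))
            (transpose-mismatch (≢top m<ℓ col≢m) (≢bottom m<ℓ col≢m))
    where col≢m = ℕP.<⇒≢ m<col ∘ ≡.sym

  τ-prefix-swaps : ∀ m m≤ℓ k → colOf T k ℕ.< m → τ-prefix m m≤ℓ ⟨$⟩ʳ k ≡ τ ⟨$⟩ʳ k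
  τ-prefix-swaps (suc m) m<ℓ k col<1+m with ℕP.m<1+n⇒m<n∨m≡n col<1+m
  ... | inj₁ col<m = ≡.trans (≡.cong t (τ-prefix-swaps m (ℕP.<⇒≤ m<ℓ) k col<m))
                             (transpose-mismatch (≢top m<ℓ col-τ≢m) (≢bottom m<ℓ col-τ≢m))
    where
    t = PC.transpose (top m m<ℓ) (bottom m m<ℓ)
    col-τ≢m = ℕP.<⇒≢ col<m ∘ ≡.trans (≡.sym (colOf-τ k))
  ... | inj₂ col≡m = ≡.trans (≡.cong t (τ-prefix-fixes m (ℕP.<⇒≤ m<ℓ) k (ℕP.≤-reflexive (≡.sym col≡m))))
                             (by-row (rowOf T k ≟ r₁) (rowOf T k ≟ r₂))
    where
    t = PC.transpose (top m m<ℓ) (bottom m m<ℓ)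
    by-row : Dec (rowOf T k ≡ r₁) → Dec (rowOf T k ≡ r₂) → t k ≡ τ ⟨$⟩ʳ k
    by-row (yes row≡r₁) _ rewrite top-unique m<ℓ row≡r₁ col≡m =
      ≡.trans (transpose-matchˡ (top m m<ℓ) (bottom m m<ℓ)) (≡.sym (τ-top m<ℓ))
    by-row (no _) (yes row≡r₂) rewrite bottom-unique m<ℓ row≡r₂ col≡m =
      ≡.trans (transpose-matchʳ (top m m<ℓ) (bottom m m<ℓ)) (≡.sym (τ-bottom m<ℓ))
    by-row (no ≢r₁) (no ≢r₂) = ≡.trans (transpose-mismatch (≢r₁ ∘ row≡r₁) (≢r₂ ∘ row≡r₂)) (≡.sym (τ-other ≢r₁ ≢r₂))
      where
      row≡r₁ : k ≡ top m m<ℓ → rowOf T k ≡ r₁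
      row≡r₁ k≡top = ≡.trans (≡.cong (rowOf T) k≡top) (rowOf-top m<ℓ)
      row≡r₂ : k ≡ bottom m m<ℓ → rowOf T k ≡ r₂
      row≡r₂ k≡bottom = ≡.trans (≡.cong (rowOf T) k≡bottom) (rowOf-bottom m<ℓ)

  sgn-τ : sgn τ ≡ -1ℤ ^ ℓ
  sgn-τ = ≡.trans (sgn-cong {σ = τ} {τ-prefix ℓ ℕP.≤-refl} τ≈τ-prefix) (sgn-τ-prefix ℓ ℕP.≤-refl)
    where
    τ≈τ-prefix : τ ≈ₚ τ-prefix ℓ ℕP.≤-refl
    τ≈τ-prefix k with colOf T k ℕ.<? ℓ
    ... | yes col<ℓ = ≡.sym (τ-prefix-swaps ℓ ℕP.≤-refl k col<ℓ)
    ... | no  col≮ℓ = ≡.trans (τ-other (row-short λr₁≡ℓ) (row-short λr₂≡ℓ))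
                              (≡.sym (τ-prefix-fixes ℓ ℕP.≤-refl k (ℕP.≮⇒≥ col≮ℓ)))
      where
      row-short : ∀ {r} → lookup sh r ≡ ℓ → rowOf T k ≢ r
      row-short λr≡ℓ row≡r =
        col≮ℓ (≡.subst (colOf T k ℕ.<_) (≡.trans (≡.cong (lookup sh) row≡r) λr≡ℓ) (proj₂ (proj₂ (cellOf k))))

v-swap-rows : ∀ {sh n} (S T U : Numbering sh n) (r₁ r₂ : Fin (length sh)) (ℓ : ℕ) →
              r₁ ≢ r₂ → lookup sh r₁ ≡ ℓ → lookup sh r₂ ≡ ℓ →
              (∀ c d → rowOfCell sh d ≡ swapRow r₁ r₂ (rowOfCell sh c) → colOfCell sh d ≡ colOfCell sh c →
                       entry U c ≡ entry T d) →
              v U S ≈ (-1ℤ ^ ℓ) • v T S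
v-swap-rows {n = n} S T U r₁ r₂ ℓ r₁≢r₂ λr₁≡ℓ λr₂≡ℓ U-swap g = begin
  coeff (v U S) g
    ≡⟨ coeff-v U S g ⟩
  ℤΣ.∑ (allPerms n) (vSummand U (σ U S) g)
    ≡⟨ ℤPerm.∑-translateˡ {f = vSummand U (σ U S) g} (λ {p} {q} → vSummand-resp U (σ U S) g {p} {q}) τ ⟨
  ℤΣ.∑ (allPerms n) (λ ζ → vSummand U (σ U S) g (τ ⊙ ζ))
    ≡⟨ ℤΣ.∑-cong (allPerms n) term ⟩
  ℤΣ.∑ (allPerms n) (λ ζ → sgn τ ℤ.* vSummand T (σ T S) g ζ)
    ≡⟨ ℤΣ.*-distribˡ-∑ (allPerms n) (sgn τ) (vSummand T (σ T S) g) ⟨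
  sgn τ ℤ.* ℤΣ.∑ (allPerms n) (vSummand T (σ T S) g)
    ≡⟨ ≡.cong₂ ℤ._*_ sgn-τ (≡.sym (coeff-v T S g)) ⟩
  (-1ℤ ^ ℓ) ℤ.* coeff (v T S) g
    ≡⟨ coeff-• (-1ℤ ^ ℓ) (v T S) g ⟨
  coeff ((-1ℤ ^ ℓ) • v T S) g ∎
  where
  open ≡.≡-Reasoning
  open RowSwap T r₁≢r₂ λr₁≡ℓ λr₂≡ℓ
  open Relabelling {T = T} {U} {τ} (U≡τ·T {U} U-swap)
  rowOf-U≡sw-rowOf-T : ∀ k → rowOf U k ≡ sw (rowOf T k)
  rowOf-U≡sw-rowOf-T k = ≡.trans (rowOf-U k) (rowOf-τ k)
  colOf-U≡colOf-T : ∀ k → colOf U k ≡ colOf T k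
  colOf-U≡colOf-T k = ≡.trans (colOf-U k) (colOf-τ k)
  term : ∀ ζ → vSummand U (σ U S) g (τ ⊙ ζ) ≡ sgn τ ℤ.* vSummand T (σ T S) g ζ
  term ζ = ≡.trans (≡.cong₂ ℤ._*_ χC (≡.cong₂ ℤ._*_ (sgn-∘ τ ζ) χR))
                   (≡.trans (≡.cong (χ (InC? T) ζ ℤ.*_) (ℤP.*-assoc (sgn τ) (sgn ζ) _))
                            (ℤ*.x∙yz≈y∙xz (χ (InC? T) ζ) (sgn τ) _))
    where
    χC : χ (InC? U) (τ ⊙ ζ) ≡ χ (InC? T) ζ
    χC = χ-⇔ (InC? U) (InC? T) {τ ⊙ ζ} {ζ}
             (Stable-∘ˡ {π = τ} colOf-τ ζ ⇔-∘ Stable-≗ colOf-U≡colOf-T (τ ⊙ ζ))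
    x = (σ T S ⊙ ζ) ⁻¹ ⊙ g
    xU = (σ U S ⊙ (τ ⊙ ζ)) ⁻¹ ⊙ g
    χR : χ (InR? U) xU ≡ χ (InR? T) x
    χR = ≡.trans (χ-⇔ (InR? U) (InR? T) {xU} {xU} (Stable-cong sw sw-injective rowOf-U≡sw-rowOf-T xU))
                 (χ-InR-resp T {xU} {x} (λ k → ≡.cong (ζ ⁻¹ ⟨$⟩ʳ_) (σ⁻¹-U S (g ⟨$⟩ʳ k))))

-- The shape need not be a partition: both parts hold for every list of row lengths.
proposition2p8 :
    ((n : ℕ) (sh : List ℕ) → IsPartition sh n →
       (S T U : Numbering sh n) (π : Permutation′ n) →
       InR T π →
       (∀ c → entry U c ≡ entry (π · T) c) →
       v U S ≈ v T S)
    ×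
    ((n : ℕ) (sh : List ℕ) → IsPartition sh n →
       (S T U : Numbering sh n) (r₁ r₂ : Fin (length sh)) (ℓ : ℕ) →
       r₁ ≢ r₂ → lookup sh r₁ ≡ ℓ → lookup sh r₂ ≡ ℓ →
       (∀ c d → rowOfCell sh d ≡ swapRow r₁ r₂ (rowOfCell sh c) →
                colOfCell sh d ≡ colOfCell sh c →
                entry U c ≡ entry T d) →
       v U S ≈ (-1ℤ ^ ℓ) • v T S)
proposition2p8 = (λ _ _ _ → v-relabel-within-rows) , (λ _ _ _ → v-swap-rows)
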